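{- For every integer $n\ge 5$, $$3b(n)-\tfrac32\le \tilde m_{\mathrm{opt}}(n)<3b(n)+\tfrac12,$$ i.e. $\tilde m_{\mathrm{opt}}(n)$ equals $\lceil 3b(n)-\frac32\rceil$ or $\lceil 3b(n)-\frac32\rceil+1$.
   Context: Let $b(n)=(1+\frac1n)\log_2(n+1)-1$. For $1\le m\le n$ put $E_m[\ell]=\sum_{j=0}^{m-1}\frac{n}{n-j}$ (the expected number of independent uniform draws from an $n$-element set needed to obtain $m$ distinct elements). Define $$\tilde F(m)=\frac{1}{E_m[\ell]}\Big(2m\,b(n)+\sum_{j=1}^{m-1}\frac{j+1}{2}\cdot\frac{j}{n-j}\Big),$$ and let $\tilde m_{\mathrm{opt}}(n)$ be the (smallest) value of $m\in\{1,2,\dots,n\}$ minimizing $\tilde F(m)$. -}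

module Defs where

open import Data.Nat as ℕ using (ℕ; zero; suc; _^_)
open import Data.Integer as ℤ using (ℤ; +_; -[1+_])
open import Data.Rational as ℚ using (ℚ; mkℚ; ↥_; ↧_; ↧ₙ_; 0ℚ; 1ℚ; _/_; _+_; _*_; _-_)
open import Data.List using (List; foldr; map; upTo; drop)
open import Data.Empty using (⊥)
open import Data.Unit using (⊤)
open import Data.Product using (_×_; Σ)
open import Relation.Nullary using (¬_)

-- Real numbers of the form  c₀ + c₁ · log₂(n+1)  with c₀ c₁ ∈ ℚ
-- (n is a fixed parameter).  Every real quantity in the statement has
-- this shape, and their order is decided exactly by integer power
-- comparisons, since  a·log₂(n+1) ≤ b  ⇔  (n+1)^a ≤ 2^b  (a,b ∈ ℕ).

-- IntCoeffLe n a b  :⇔  a · log₂(n+1) ≤ b     (a b : ℤ)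
IntCoeffLe : ℕ → ℤ → ℤ → Set
IntCoeffLe n (+ zero)    b          = + 0 ℤ.≤ b
IntCoeffLe n (+ suc k)   (+ j)      = suc n ^ suc k ℕ.≤ 2 ^ j
IntCoeffLe n (+ suc k)   -[1+ j ]   = ⊥
IntCoeffLe n -[1+ k ]    (+ j)      = ⊤
IntCoeffLe n -[1+ k ]    -[1+ j ]   = 2 ^ suc j ℕ.≤ suc n ^ suc k

QCoeffLe : ℕ → ℚ → ℚ → Set
QCoeffLe n q r = IntCoeffLe n (↥ q ℤ.* ↧ r) (↥ r ℤ.* ↧ q)

-- the real number  const + coeff · log₂(n+1)
record LogAff : Set where
  constructor ⟨_,_⟩
  field
    const : ℚ
    coeff : ℚ
open LogAff public

_≤[_]_ : LogAff → ℕ → LogAff → Set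
x ≤[ n ] y = QCoeffLe n (coeff x - coeff y) (const y - const x)

_<[_]_ : LogAff → ℕ → LogAff → Set
x <[ n ] y = ¬ (y ≤[ n ] x)

_⊕_ : LogAff → LogAff → LogAff
x ⊕ y = ⟨ const x + const y , coeff x + coeff y ⟩

_⊛_ : ℚ → LogAff → LogAff
q ⊛ x = ⟨ q * const x , q * coeff x ⟩

ofℚ : ℚ → LogAff
ofℚ q = ⟨ q , 0ℚ ⟩

log2suc : LogAff
log2suc = ⟨ 0ℚ , 1ℚ ⟩

-- a / d as a rational (junk value 0 when d = 0; never used with d = 0)
frac : ℕ → ℕ → ℚ
frac a zero    = 0ℚ
frac a (suc d) = (+ a) / suc d

-- multiplicative inverse (junk value 0 at 0; only applied to E_m > 0)
inv : ℚ → ℚ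
inv (mkℚ (+ zero)  d _) = 0ℚ
inv (mkℚ (+ suc k) d _) = (+ suc d) / suc k
inv (mkℚ -[1+ k ]  d _) = ℤ.- (+ suc d) / suc k

sumℚ : List ℚ → ℚ
sumℚ = foldr _+_ 0ℚ

ℕtoℚ : ℕ → ℚ
ℕtoℚ m = (+ m) / 1

b : ℕ → LogAff
b n = ⟨ ℚ.- 1ℚ , 1ℚ + frac 1 n ⟩

E : ℕ → ℕ → ℚ
E n m = sumℚ (map (λ j → frac n (n ℕ.∸ j)) (upTo m))

R : ℕ → ℕ → ℚ
R n m = sumℚ (map (λ j → frac (suc j) 2 * frac j (n ℕ.∸ j)) (drop 1 (upTo m)))

Ftilde : ℕ → ℕ → LogAff
Ftilde n m = inv (E n m) ⊛ ((ℕtoℚ (2 ℕ.* m) ⊛ b n) ⊕ ofℚ (R n m))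

IsMOpt : ℕ → ℕ → Set
IsMOpt n m =
  (1 ℕ.≤ m × m ℕ.≤ n)
  × ((k : ℕ) → 1 ℕ.≤ k → k ℕ.≤ n → Ftilde n m ≤[ n ] Ftilde n k)
  × ((k : ℕ) → 1 ℕ.≤ k → k ℕ.< m → Ftilde n m <[ n ] Ftilde n k)

module Submission where

-- Since E_{m+1} = E_m + e_m and R_{m+1} = R_m + ρ_m, neighbours compare as
-- F̃(m) ≤ F̃(m+1) ⇔ 2Δ_m · b(n) ≤ Γ_m, with Δ_m = m e_m − E_m > 0 and Γ_m = ρ_m E_m − R_m e_m.
-- Both are sums over j < m of multiples of x_j (m − j), x_j = 1/(n − j), and the identity
-- (3n + c) x_j = 3 + (3j + c) x_j reduces them to polynomial sums, giving (2m+1) Δ_m ≤ 3 Γ_m,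
-- and 3 Γ_m ≤ (2m+3) Δ_m whenever m² + 25m + 30 ≤ 24n. The first inequality stops the smallest
-- minimiser from reaching 3b + 1/2, the second keeps it above 3b − 3/2. The cases left over
-- (m = 1, m = n, and m² + 25m + 30 > 24n for n ≥ 9) are comparisons of powers, as
-- a·log₂(n+1) ≤ c means (n+1)^a ≤ 2^c; for n ≤ 8 the second inequality is checked by evaluation.

open import Defs
open import Data.Empty using (⊥-elim)
open import Data.Integer as ℤ using (ℤ; +_; -[1+_]; +[1+_])
import Data.Integer.Properties as ℤ
import Data.Integer.Tactic.RingSolver as ℤ-Solver
open import Data.List using ([]; _∷_; map; applyUpTo)
open import Data.Maybe using (Maybe; just; nothing)
open import Data.Nat as ℕ using (ℕ; zero; suc; _^_; z≤n; s≤s)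
import Data.Nat.Properties as ℕ
import Data.Nat.Tactic.RingSolver as ℕ-Solver
open import Data.Product using (_×_; _,_; ∃)
open import Data.Rational as ℚ using (ℚ; mkℚ; 0ℚ; 1ℚ; _+_; _*_; _-_; -_; _≤_; _<_; _/_; toℚᵘ)
import Data.Rational.Properties as ℚ
open import Data.Rational.Unnormalised as ℚᵘ using (ℚᵘ; mkℚᵘ; *≡*)
import Data.Rational.Unnormalised.Properties as ℚᵘ
open import Data.Sum using (_⊎_; inj₁; inj₂)
open import Data.Unit using (tt)
open import Function using (_⇔_; mk⇔; Equivalence; _∘_)
open import Level using (0ℓ)
open import Relation.Binary.PropositionalEquality
  using (_≡_; refl; sym; trans; cong; cong₂; subst; subst₂; module ≡-Reasoning)
open import Relation.Nullary using (¬_; Dec; yes; no)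
open import Relation.Nullary.Decidable using (map′; toWitness; _→-dec_)
open import Tactic.RingSolver using (solve-∀; solve)
open import Tactic.RingSolver.Core.AlmostCommutativeRing using (AlmostCommutativeRing; fromCommutativeRing)

open import Algebra.Properties.CommutativeSemigroup ℕ.*-commutativeSemigroup using (interchange)

open Equivalence using (to; from)

ℚ-ring : AlmostCommutativeRing 0ℓ 0ℓ
ℚ-ring = fromCommutativeRing ℚ.+-*-commutativeRing isZero
  where
  isZero : ∀ x → Maybe (0ℚ ≡ x)
  isZero x with 0ℚ ℚ.≟ x
  ... | yes p = just p
  ... | no _  = nothing

p≤q⇒0≤q-p : ∀ {p q} → p ≤ q → 0ℚ ≤ q - p
p≤q⇒0≤q-p {p} {q} h = subst (_≤ q - p) (ℚ.+-inverseʳ p) (ℚ.+-monoˡ-≤ (- p) h)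

0≤q-p⇒p≤q : ∀ {p q} → 0ℚ ≤ q - p → p ≤ q
0≤q-p⇒p≤q {p} {q} h = subst₂ _≤_ (ℚ.+-identityˡ p) (shift p q) (ℚ.+-monoˡ-≤ p h)
  where
  shift : ∀ p q → q - p + p ≡ q
  shift = solve-∀ ℚ-ring

*-nonNeg : ∀ {p q} → 0ℚ ≤ p → 0ℚ ≤ q → 0ℚ ≤ p * q
*-nonNeg {p} {q} hp hq = ℚ.nonNegative⁻¹ (p * q)
  {{ℚ.nonNeg*nonNeg⇒nonNeg p {{ℚ.nonNegative hp}} q {{ℚ.nonNegative hq}}}}

*-pos : ∀ {p q} → 0ℚ < p → 0ℚ < q → 0ℚ < p * q
*-pos {p} {q} hp hq = ℚ.positive⁻¹ (p * q) {{ℚ.pos*pos⇒pos p {{ℚ.positive hp}} q {{ℚ.positive hq}}}}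

square-nonNeg : ∀ p → 0ℚ ≤ p * p
square-nonNeg p with ℚ.≤-total 0ℚ p
... | inj₁ 0≤p = *-nonNeg 0≤p 0≤p
... | inj₂ p≤0 = subst (0ℚ ≤_) (neg*neg p) (*-nonNeg 0≤-p 0≤-p)
  where
  0≤-p : 0ℚ ≤ - p
  0≤-p = ℚ.neg-antimono-≤ p≤0
  neg*neg : ∀ p → - p * - p ≡ p * p
  neg*neg = solve-∀ ℚ-ring

nonNeg-cancelˡ : ∀ {k p} → 0ℚ < k → 0ℚ ≤ k * p → 0ℚ ≤ p
nonNeg-cancelˡ {k} {p} hk h = ℚ.*-cancelˡ-≤-pos k {{ℚ.positive hk}} (subst (_≤ k * p) (sym (ℚ.*-zeroʳ k)) h)

ℕtoℚ-suc : ∀ m → ℕtoℚ (suc m) ≡ 1ℚ + ℕtoℚ m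
ℕtoℚ-suc m = ℚ.toℚᵘ-injective (begin
  toℚᵘ (ℕtoℚ (suc m))                   ≈⟨ ℚ.toℚᵘ-fromℚᵘ (mkℚᵘ (+ suc m) 0) ⟩
  mkℚᵘ (+ suc m) 0                      ≈⟨ *≡* (unfold (+ m)) ⟩
  mkℚᵘ (+ 1) 0 ℚᵘ.+ mkℚᵘ (+ m) 0        ≈⟨ ℚᵘ.+-congʳ (mkℚᵘ (+ 1) 0) (ℚᵘ.≃-sym (ℚ.toℚᵘ-fromℚᵘ (mkℚᵘ (+ m) 0))) ⟩
  toℚᵘ 1ℚ ℚᵘ.+ toℚᵘ (ℕtoℚ m)            ≈⟨ ℚᵘ.≃-sym (ℚ.toℚᵘ-homo-+ 1ℚ (ℕtoℚ m)) ⟩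
  toℚᵘ (1ℚ + ℕtoℚ m)                    ∎)
  where
  open ℚᵘ.≃-Reasoning
  unfold : ∀ x → (+ 1 ℤ.+ x) ℤ.* + 1 ≡ (+ 1 ℤ.* + 1 ℤ.+ x ℤ.* + 1) ℤ.* + 1
  unfold = ℤ-Solver.solve-∀

ℕtoℚ-+ : ∀ a b → ℕtoℚ (a ℕ.+ b) ≡ ℕtoℚ a + ℕtoℚ b
ℕtoℚ-+ zero    b = sym (ℚ.+-identityˡ (ℕtoℚ b))
ℕtoℚ-+ (suc a) b = begin
  ℕtoℚ (suc (a ℕ.+ b))              ≡⟨ ℕtoℚ-suc (a ℕ.+ b) ⟩
  1ℚ + ℕtoℚ (a ℕ.+ b)               ≡⟨ cong (λ x → 1ℚ + x) (ℕtoℚ-+ a b) ⟩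
  1ℚ + (ℕtoℚ a + ℕtoℚ b)            ≡⟨ sym (ℚ.+-assoc 1ℚ (ℕtoℚ a) (ℕtoℚ b)) ⟩
  1ℚ + ℕtoℚ a + ℕtoℚ b              ≡⟨ cong (_+ ℕtoℚ b) (sym (ℕtoℚ-suc a)) ⟩
  ℕtoℚ (suc a) + ℕtoℚ b             ∎
  where open ≡-Reasoning

ℕtoℚ-* : ∀ a b → ℕtoℚ (a ℕ.* b) ≡ ℕtoℚ a * ℕtoℚ b
ℕtoℚ-* zero    b = sym (ℚ.*-zeroˡ (ℕtoℚ b))
ℕtoℚ-* (suc a) b = begin
  ℕtoℚ (b ℕ.+ a ℕ.* b)              ≡⟨ ℕtoℚ-+ b (a ℕ.* b) ⟩
  ℕtoℚ b + ℕtoℚ (a ℕ.* b)           ≡⟨ cong (λ x → ℕtoℚ b + x) (ℕtoℚ-* a b) ⟩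
  ℕtoℚ b + ℕtoℚ a * ℕtoℚ b          ≡⟨ distrib (ℕtoℚ a) (ℕtoℚ b) ⟩
  (1ℚ + ℕtoℚ a) * ℕtoℚ b            ≡⟨ cong (_* ℕtoℚ b) (sym (ℕtoℚ-suc a)) ⟩
  ℕtoℚ (suc a) * ℕtoℚ b             ∎
  where
  open ≡-Reasoning
  distrib : ∀ x y → y + x * y ≡ (1ℚ + x) * y
  distrib = solve-∀ ℚ-ring

ℕtoℚ-∸ : ∀ {a b} → b ℕ.≤ a → ℕtoℚ (a ℕ.∸ b) ≡ ℕtoℚ a - ℕtoℚ b
ℕtoℚ-∸ {a} {b} b≤a = begin
  ℕtoℚ (a ℕ.∸ b)                       ≡⟨ add-sub (ℕtoℚ (a ℕ.∸ b)) (ℕtoℚ b) ⟩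
  ℕtoℚ (a ℕ.∸ b) + ℕtoℚ b - ℕtoℚ b     ≡⟨ cong (_- ℕtoℚ b) (sym (ℕtoℚ-+ (a ℕ.∸ b) b)) ⟩
  ℕtoℚ (a ℕ.∸ b ℕ.+ b) - ℕtoℚ b        ≡⟨ cong (λ x → ℕtoℚ x - ℕtoℚ b) (ℕ.m∸n+n≡m b≤a) ⟩
  ℕtoℚ a - ℕtoℚ b                      ∎
  where
  open ≡-Reasoning
  add-sub : ∀ x y → x ≡ x + y - y
  add-sub = solve-∀ ℚ-ring

ℕtoℚ-nonNeg : ∀ a → 0ℚ ≤ ℕtoℚ a
ℕtoℚ-nonNeg a = ℚ.nonNegative⁻¹ _ {{ℚ.normalize-nonNeg a 1}}

ℕtoℚ-pos : ∀ {a} → 0 ℕ.< a → 0ℚ < ℕtoℚ a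
ℕtoℚ-pos {suc a} _ = ℚ.positive⁻¹ _ {{ℚ.normalize-pos (suc a) 1}}

frac-pos : ∀ {a d} → 0 ℕ.< a → 0 ℕ.< d → 0ℚ < frac a d
frac-pos {suc a} {suc d} _ _ = ℚ.positive⁻¹ _ {{ℚ.normalize-pos (suc a) (suc d)}}

frac-*-cancel : ∀ a {d} → 0 ℕ.< d → frac a d * ℕtoℚ d ≡ ℕtoℚ a
frac-*-cancel a {suc d} _ = ℚ.toℚᵘ-injective (begin
  toℚᵘ (frac a (suc d) * ℕtoℚ (suc d))               ≈⟨ ℚ.toℚᵘ-homo-* (frac a (suc d)) (ℕtoℚ (suc d)) ⟩
  toℚᵘ (frac a (suc d)) ℚᵘ.* toℚᵘ (ℕtoℚ (suc d))     ≈⟨ ℚᵘ.*-cong (ℚ.toℚᵘ-fromℚᵘ (mkℚᵘ (+ a) d)) (ℚ.toℚᵘ-fromℚᵘ (mkℚᵘ (+ suc d) 0)) ⟩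
  mkℚᵘ (+ a) d ℚᵘ.* mkℚᵘ (+ suc d) 0                 ≈⟨ *≡* (cancel (+ a) (+ suc d)) ⟩
  mkℚᵘ (+ a) 0                                       ≈⟨ ℚᵘ.≃-sym (ℚ.toℚᵘ-fromℚᵘ (mkℚᵘ (+ a) 0)) ⟩
  toℚᵘ (ℕtoℚ a)                                      ∎)
  where
  open ℚᵘ.≃-Reasoning
  cancel : ∀ x y → (x ℤ.* y) ℤ.* + 1 ≡ x ℤ.* (y ℤ.* + 1)
  cancel = ℤ-Solver.solve-∀

frac-split : ∀ a {d} → 0 ℕ.< d → frac a d ≡ ℕtoℚ a * frac 1 d
frac-split a {d} 0<d = begin
  frac a d                                ≡⟨ sym (ℚ.*-identityʳ (frac a d)) ⟩
  frac a d * 1ℚ                           ≡⟨ cong (λ x → frac a d * x) (sym (frac-*-cancel 1 0<d)) ⟩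
  frac a d * (frac 1 d * ℕtoℚ d)          ≡⟨ regroup (frac a d) (frac 1 d) (ℕtoℚ d) ⟩
  frac a d * ℕtoℚ d * frac 1 d            ≡⟨ cong (_* frac 1 d) (frac-*-cancel a 0<d) ⟩
  ℕtoℚ a * frac 1 d                       ∎
  where
  open ≡-Reasoning
  regroup : ∀ x u D → x * (u * D) ≡ x * D * u
  regroup = solve-∀ ℚ-ring

frac-unique : ∀ {q} a {d} → 0 ℕ.< d → q * ℕtoℚ d ≡ ℕtoℚ a → q ≡ frac a d
frac-unique {q} a {d} 0<d e = begin
  q                               ≡⟨ sym (ℚ.*-identityʳ q) ⟩
  q * 1ℚ                          ≡⟨ cong (λ x → q * x) (sym (frac-*-cancel 1 0<d)) ⟩
  q * (frac 1 d * ℕtoℚ d)         ≡⟨ regroup q (frac 1 d) (ℕtoℚ d) ⟩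
  q * ℕtoℚ d * frac 1 d           ≡⟨ cong (_* frac 1 d) e ⟩
  ℕtoℚ a * frac 1 d               ≡⟨ sym (frac-split a 0<d) ⟩
  frac a d                        ∎
  where
  open ≡-Reasoning
  regroup : ∀ x u D → x * (u * D) ≡ x * D * u
  regroup = solve-∀ ℚ-ring

frac-zero : ∀ d → frac 0 d ≡ 0ℚ
frac-zero zero    = refl
frac-zero (suc d) = trans (frac-split 0 {suc d} (s≤s z≤n)) (ℚ.*-zeroˡ (frac 1 (suc d)))

inv-*-cancel : ∀ {q} → 0ℚ < q → inv q * q ≡ 1ℚ
inv-*-cancel {q} 0<q = cancel q {{ℚ.positive 0<q}}
  where
  cancel : ∀ q .{{_ : ℚ.Positive q}} → inv q * q ≡ 1ℚ
  cancel q@(mkℚ +[1+ k ] d _) = ℚ.toℚᵘ-injective (begin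
    toℚᵘ (inv q * q)                          ≈⟨ ℚ.toℚᵘ-homo-* (inv q) q ⟩
    toℚᵘ (inv q) ℚᵘ.* mkℚᵘ +[1+ k ] d         ≈⟨ ℚᵘ.*-congʳ (ℚ.toℚᵘ-fromℚᵘ (mkℚᵘ +[1+ d ] k)) ⟩
    mkℚᵘ +[1+ d ] k ℚᵘ.* mkℚᵘ +[1+ k ] d      ≈⟨ *≡* (swap +[1+ d ] +[1+ k ]) ⟩
    toℚᵘ 1ℚ                                   ∎)
    where
    open ℚᵘ.≃-Reasoning
    swap : ∀ x y → (x ℤ.* y) ℤ.* + 1 ≡ + 1 ℤ.* (y ℤ.* x)
    swap = ℤ-Solver.solve-∀

∑< : ℕ → (ℕ → ℚ) → ℚ
∑< zero    f = 0ℚ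
∑< (suc m) f = ∑< m f + f m

syntax ∑< m (λ j → e) = ∑[ j < m ] e

∑-front : ∀ (f : ℕ → ℚ) m → ∑[ j < suc m ] f j ≡ f 0 + ∑[ j < m ] f (suc j)
∑-front f zero    = trans (ℚ.+-identityˡ (f 0)) (sym (ℚ.+-identityʳ (f 0)))
∑-front f (suc m) = trans (cong (_+ f (suc m)) (∑-front f m)) (ℚ.+-assoc (f 0) _ (f (suc m)))

sumℚ-applyUpTo : ∀ (f : ℕ → ℚ) g m → sumℚ (map f (applyUpTo g m)) ≡ ∑[ j < m ] f (g j)
sumℚ-applyUpTo f g zero    = refl
sumℚ-applyUpTo f g (suc m) =
  trans (cong (λ x → f (g 0) + x) (sumℚ-applyUpTo f (g ∘ suc) m)) (sym (∑-front (f ∘ g) m))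

∑-cong : ∀ {f g : ℕ → ℚ} m → (∀ j → j ℕ.< m → f j ≡ g j) → ∑[ j < m ] f j ≡ ∑[ j < m ] g j
∑-cong zero    _ = refl
∑-cong (suc m) h = cong₂ _+_ (∑-cong m (λ j j<m → h j (ℕ.m<n⇒m<1+n j<m))) (h m ℕ.≤-refl)

∑-mono-≤ : ∀ {f g : ℕ → ℚ} m → (∀ j → j ℕ.< m → f j ≤ g j) → ∑[ j < m ] f j ≤ ∑[ j < m ] g j
∑-mono-≤ zero    _ = ℚ.≤-refl
∑-mono-≤ (suc m) h = ℚ.+-mono-≤ (∑-mono-≤ m (λ j j<m → h j (ℕ.m<n⇒m<1+n j<m))) (h m ℕ.≤-refl)

∑-nonNeg : ∀ {f : ℕ → ℚ} m → (∀ j → j ℕ.< m → 0ℚ ≤ f j) → 0ℚ ≤ ∑[ j < m ] f j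
∑-nonNeg zero    _ = ℚ.≤-refl
∑-nonNeg (suc m) h = ℚ.+-mono-≤ (∑-nonNeg m (λ j j<m → h j (ℕ.m<n⇒m<1+n j<m))) (h m ℕ.≤-refl)

∑-pos : ∀ {f : ℕ → ℚ} m → 0 ℕ.< m → (∀ j → j ℕ.< m → 0ℚ < f j) → 0ℚ < ∑[ j < m ] f j
∑-pos (suc m) _ h =
  ℚ.+-mono-≤-< (∑-nonNeg m (λ j j<m → ℚ.<⇒≤ (h j (ℕ.m<n⇒m<1+n j<m)))) (h m ℕ.≤-refl)

∑-linear : ∀ a b (f g : ℕ → ℚ) m →
           ∑[ j < m ] (a * f j + b * g j) ≡ a * ∑[ j < m ] f j + b * ∑[ j < m ] g j
∑-linear a b f g zero    = solve (a ∷ b ∷ []) ℚ-ring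
∑-linear a b f g (suc m) = trans (cong (_+ (a * f m + b * g m)) (∑-linear a b f g m)) (regroup a b _ _ (f m) (g m))
  where
  regroup : ∀ a b F G x y → a * F + b * G + (a * x + b * y) ≡ a * (F + x) + b * (G + y)
  regroup = solve-∀ ℚ-ring

∑-scale : ∀ a (f : ℕ → ℚ) m → ∑[ j < m ] (a * f j) ≡ a * ∑[ j < m ] f j
∑-scale a f zero    = sym (ℚ.*-zeroʳ a)
∑-scale a f (suc m) = trans (cong (_+ a * f m) (∑-scale a f m)) (sym (ℚ.*-distribˡ-+ a _ (f m)))

∑-const : ∀ c m → ∑[ j < m ] c ≡ c * ℕtoℚ m
∑-const c zero    = sym (ℚ.*-zeroʳ c)
∑-const c (suc m) = begin
  ∑[ j < m ] c + c          ≡⟨ cong (_+ c) (∑-const c m) ⟩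
  c * ℕtoℚ m + c            ≡⟨ distrib c (ℕtoℚ m) ⟩
  c * (1ℚ + ℕtoℚ m)         ≡⟨ cong (λ t → c * t) (sym (ℕtoℚ-suc m)) ⟩
  c * ℕtoℚ (suc m)          ∎
  where
  open ≡-Reasoning
  distrib : ∀ c x → c * x + c ≡ c * (1ℚ + x)
  distrib = solve-∀ ℚ-ring

½ ⅙ ¼ : ℚ
½ = frac 1 2
⅙ = frac 1 6
¼ = frac 1 4

∑-cubic : ∀ a b c d m →
  ∑[ j < m ] (a + b * ℕtoℚ j + c * ℕtoℚ j * ℕtoℚ j + d * ℕtoℚ j * ℕtoℚ j * ℕtoℚ j) ≡
  a * ℕtoℚ m + b * ½ * ℕtoℚ m * (ℕtoℚ m - 1ℚ)
    + c * ⅙ * ℕtoℚ m * (ℕtoℚ m - 1ℚ) * (ℕtoℚ m + ℕtoℚ m - 1ℚ)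
    + d * ¼ * ℕtoℚ m * ℕtoℚ m * (ℕtoℚ m - 1ℚ) * (ℕtoℚ m - 1ℚ)
∑-cubic a b c d zero    = solve (a ∷ b ∷ c ∷ d ∷ []) ℚ-ring
∑-cubic a b c d (suc m) = begin
  _ ≡⟨ cong (_+ (a + b * ℕtoℚ m + c * ℕtoℚ m * ℕtoℚ m + d * ℕtoℚ m * ℕtoℚ m * ℕtoℚ m)) (∑-cubic a b c d m) ⟩
  _ ≡⟨ step (ℕtoℚ m) ⟩
  _ ≡⟨ cong closed (sym (ℕtoℚ-suc m)) ⟩
  _ ∎
  where
  open ≡-Reasoning
  closed : ℚ → ℚ
  closed M = a * M + b * ½ * M * (M - 1ℚ) + c * ⅙ * M * (M - 1ℚ) * (M + M - 1ℚ)
             + d * ¼ * M * M * (M - 1ℚ) * (M - 1ℚ)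
  step : ∀ M →
    a * M + b * ½ * M * (M - 1ℚ) + c * ⅙ * M * (M - 1ℚ) * (M + M - 1ℚ)
      + d * ¼ * M * M * (M - 1ℚ) * (M - 1ℚ) + (a + b * M + c * M * M + d * M * M * M) ≡
    a * (1ℚ + M) + b * ½ * (1ℚ + M) * (1ℚ + M - 1ℚ)
      + c * ⅙ * (1ℚ + M) * (1ℚ + M - 1ℚ) * (1ℚ + M + (1ℚ + M) - 1ℚ)
      + d * ¼ * (1ℚ + M) * (1ℚ + M) * (1ℚ + M - 1ℚ) * (1ℚ + M - 1ℚ)
  step M = solve (M ∷ a ∷ b ∷ c ∷ d ∷ []) ℚ-ring

-- The order q · log₂(n + 1) ≤ r

^-distribʳ-* : ∀ a b k → (a ℕ.* b) ^ k ≡ a ^ k ℕ.* b ^ k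
^-distribʳ-* a b zero    = refl
^-distribʳ-* a b (suc k) = begin
  a ℕ.* b ℕ.* (a ℕ.* b) ^ k         ≡⟨ cong (a ℕ.* b ℕ.*_) (^-distribʳ-* a b k) ⟩
  a ℕ.* b ℕ.* (a ^ k ℕ.* b ^ k)     ≡⟨ interchange a b (a ^ k) (b ^ k) ⟩
  a ℕ.* a ^ k ℕ.* (b ℕ.* b ^ k)     ∎
  where open ≡-Reasoning

posPart negPart : ℤ → ℕ
posPart (+ k)    = k
posPart -[1+ k ] = 0
negPart (+ k)    = 0
negPart -[1+ k ] = suc k

split : ∀ a → a ≡ + posPart a ℤ.- + negPart a
split (+ k)    = sym (ℤ.+-identityʳ (+ k))
split -[1+ k ] = refl

split-+ : ∀ a c → a ℤ.+ c ≡ + (posPart a ℕ.+ posPart c) ℤ.- + (negPart a ℕ.+ negPart c)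
split-+ a c = begin
  a ℤ.+ c                                                  ≡⟨ cong₂ ℤ._+_ (split a) (split c) ⟩
  (+ posPart a ℤ.- + negPart a) ℤ.+ (+ posPart c ℤ.- + negPart c)
    ≡⟨ regroup (+ posPart a) (+ negPart a) (+ posPart c) (+ negPart c) ⟩
  (+ posPart a ℤ.+ + posPart c) ℤ.- (+ negPart a ℤ.+ + negPart c)
    ≡⟨ sym (cong₂ ℤ._-_ (ℤ.pos-+ (posPart a) (posPart c)) (ℤ.pos-+ (negPart a) (negPart c))) ⟩
  + (posPart a ℕ.+ posPart c) ℤ.- + (negPart a ℕ.+ negPart c) ∎
  where
  open ≡-Reasoning
  regroup : ∀ w x y z → (w ℤ.- x) ℤ.+ (y ℤ.- z) ≡ (w ℤ.+ y) ℤ.- (x ℤ.+ z)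
  regroup = ℤ-Solver.solve-∀

split-* : ∀ k a → + k ℤ.* a ≡ + (posPart a ℕ.* k) ℤ.- + (negPart a ℕ.* k)
split-* k a = begin
  + k ℤ.* a                                          ≡⟨ cong (+ k ℤ.*_) (split a) ⟩
  + k ℤ.* (+ posPart a ℤ.- + negPart a)              ≡⟨ distrib (+ k) (+ posPart a) (+ negPart a) ⟩
  + posPart a ℤ.* + k ℤ.- + negPart a ℤ.* + k        ≡⟨ sym (cong₂ ℤ._-_ (ℤ.pos-* (posPart a) k) (ℤ.pos-* (negPart a) k)) ⟩
  + (posPart a ℕ.* k) ℤ.- + (negPart a ℕ.* k)        ∎
  where
  open ≡-Reasoning
  distrib : ∀ x y z → x ℤ.* (y ℤ.- z) ≡ y ℤ.* x ℤ.- z ℤ.* x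
  distrib = ℤ-Solver.solve-∀

split-neg : ∀ a → ℤ.- a ≡ + negPart a ℤ.- + posPart a
split-neg a = trans (cong ℤ.-_ (split a)) (negate (+ posPart a) (+ negPart a))
  where
  negate : ∀ x y → ℤ.- (x ℤ.- y) ≡ y ℤ.- x
  negate = ℤ-Solver.solve-∀

split-unique : ∀ {p p′ q q′} → + p ℤ.- + p′ ≡ + q ℤ.- + q′ → p ℕ.+ q′ ≡ q ℕ.+ p′
split-unique {p} {p′} {q} {q′} e = ℤ.+-injective (begin
  + (p ℕ.+ q′)                          ≡⟨ ℤ.pos-+ p q′ ⟩
  + p ℤ.+ + q′                          ≡⟨ regroup (+ p) (+ p′) (+ q′) ⟩
  (+ p ℤ.- + p′) ℤ.+ (+ p′ ℤ.+ + q′)    ≡⟨ cong (ℤ._+ (+ p′ ℤ.+ + q′)) e ⟩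
  (+ q ℤ.- + q′) ℤ.+ (+ p′ ℤ.+ + q′)    ≡⟨ cancel (+ q) (+ q′) (+ p′) ⟩
  + q ℤ.+ + p′                          ≡⟨ sym (ℤ.pos-+ q p′) ⟩
  + (q ℕ.+ p′)                          ∎)
  where
  open ≡-Reasoning
  regroup : ∀ x y z → x ℤ.+ z ≡ (x ℤ.- y) ℤ.+ (y ℤ.+ z)
  regroup = ℤ-Solver.solve-∀
  cancel : ∀ x y z → (x ℤ.- y) ℤ.+ (z ℤ.+ y) ≡ x ℤ.+ z
  cancel = ℤ-Solver.solve-∀

module _ (n : ℕ) where

  private
    N : ℕ
    N = suc n

  -- (p − p′) · log₂ N ≤ s − s′, as a record so that the exponents can be inferred
  record PowLe (p p′ s s′ : ℕ) : Set where
    constructor powLe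
    field
      ≤-pow : N ^ p ℕ.* 2 ^ s′ ℕ.≤ 2 ^ s ℕ.* N ^ p′

  open PowLe

  PowLe-shift : ∀ {p p′ s s′} k l →
    PowLe p p′ s s′ ⇔ PowLe (p ℕ.+ k) (p′ ℕ.+ k) (s ℕ.+ l) (s′ ℕ.+ l)
  PowLe-shift {p} {p′} {s} {s′} k l = mk⇔
    (λ (powLe h) → powLe (subst₂ ℕ._≤_ (sym lhs) (sym rhs) (ℕ.*-monoˡ-≤ c h)))
    (λ (powLe h) → powLe (ℕ.*-cancelʳ-≤ _ _ c {{c≢0}} (subst₂ ℕ._≤_ lhs rhs h)))
    where
    c : ℕ
    c = N ^ k ℕ.* 2 ^ l
    c≢0 : ℕ.NonZero c
    c≢0 = ℕ.m*n≢0 _ _ {{ℕ.m^n≢0 N k}} {{ℕ.m^n≢0 2 l}}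
    lhs : N ^ (p ℕ.+ k) ℕ.* 2 ^ (s′ ℕ.+ l) ≡ N ^ p ℕ.* 2 ^ s′ ℕ.* c
    lhs = trans (cong₂ ℕ._*_ (ℕ.^-distribˡ-+-* N p k) (ℕ.^-distribˡ-+-* 2 s′ l))
                (interchange (N ^ p) (N ^ k) (2 ^ s′) (2 ^ l))
    rhs : 2 ^ (s ℕ.+ l) ℕ.* N ^ (p′ ℕ.+ k) ≡ 2 ^ s ℕ.* N ^ p′ ℕ.* c
    rhs = trans (cong₂ ℕ._*_ (ℕ.^-distribˡ-+-* 2 s l) (ℕ.^-distribˡ-+-* N p′ k))
          (trans (interchange (2 ^ s) (2 ^ l) (N ^ p′) (N ^ k))
                 (cong (2 ^ s ℕ.* N ^ p′ ℕ.*_) (ℕ.*-comm (2 ^ l) (N ^ k))))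

  PowLe-resp : ∀ {p p′ s s′ q q′ t t′} → p ℕ.+ q′ ≡ q ℕ.+ p′ → s ℕ.+ t′ ≡ t ℕ.+ s′ →
               PowLe p p′ s s′ → PowLe q q′ t t′
  PowLe-resp {p} {p′} {s} {s′} {q} {q′} {t} {t′} ep es h =
    from (PowLe-shift p′ s′)
      (subst₂ (λ a b → PowLe a (q′ ℕ.+ p′) b (t′ ℕ.+ s′)) ep es
        (subst₂ (λ a b → PowLe (p ℕ.+ q′) a (s ℕ.+ t′) b) (ℕ.+-comm p′ q′) (ℕ.+-comm s′ t′)
          (to (PowLe-shift q′ t′) h)))

  PowLe-+ : ∀ {p p′ s s′ q q′ t t′} → PowLe p p′ s s′ → PowLe q q′ t t′ →
            PowLe (p ℕ.+ q) (p′ ℕ.+ q′) (s ℕ.+ t) (s′ ℕ.+ t′)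
  PowLe-+ {p} {p′} {s} {s′} {q} {q′} {t} {t′} (powLe h₁) (powLe h₂) = powLe (begin
    N ^ (p ℕ.+ q) ℕ.* 2 ^ (s′ ℕ.+ t′)          ≡⟨ cong₂ ℕ._*_ (ℕ.^-distribˡ-+-* N p q) (ℕ.^-distribˡ-+-* 2 s′ t′) ⟩
    N ^ p ℕ.* N ^ q ℕ.* (2 ^ s′ ℕ.* 2 ^ t′)    ≡⟨ interchange (N ^ p) (N ^ q) (2 ^ s′) (2 ^ t′) ⟩
    N ^ p ℕ.* 2 ^ s′ ℕ.* (N ^ q ℕ.* 2 ^ t′)    ≤⟨ ℕ.*-mono-≤ h₁ h₂ ⟩
    2 ^ s ℕ.* N ^ p′ ℕ.* (2 ^ t ℕ.* N ^ q′)    ≡⟨ interchange (2 ^ s) (N ^ p′) (2 ^ t) (N ^ q′) ⟩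
    2 ^ s ℕ.* 2 ^ t ℕ.* (N ^ p′ ℕ.* N ^ q′)    ≡⟨ sym (cong₂ ℕ._*_ (ℕ.^-distribˡ-+-* 2 s t) (ℕ.^-distribˡ-+-* N p′ q′)) ⟩
    2 ^ (s ℕ.+ t) ℕ.* N ^ (p′ ℕ.+ q′)          ∎)
    where open ℕ.≤-Reasoning

  PowLe-*⇔ : ∀ {p p′ s s′} k →
    PowLe p p′ s s′ ⇔ PowLe (p ℕ.* suc k) (p′ ℕ.* suc k) (s ℕ.* suc k) (s′ ℕ.* suc k)
  PowLe-*⇔ {p} {p′} {s} {s′} k = mk⇔
    (λ (powLe h) → powLe (subst₂ ℕ._≤_ (power N p 2 s′) (power 2 s N p′) (ℕ.^-monoˡ-≤ (suc k) h)))
    (λ (powLe h) → powLe (ℕ.≮⇒≥ (λ gt → ℕ.<⇒≱ (ℕ.^-monoˡ-< (suc k) gt)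
                          (subst₂ ℕ._≤_ (sym (power N p 2 s′)) (sym (power 2 s N p′)) h))))
    where
    power : ∀ a i b j → (a ^ i ℕ.* b ^ j) ^ suc k ≡ a ^ (i ℕ.* suc k) ℕ.* b ^ (j ℕ.* suc k)
    power a i b j = trans (^-distribʳ-* (a ^ i) (b ^ j) (suc k))
                          (cong₂ ℕ._*_ (ℕ.^-*-assoc a i (suc k)) (ℕ.^-*-assoc b j (suc k)))

  PowLe-flip : ∀ {p p′ s s′} → ¬ PowLe p p′ s s′ → PowLe p′ p s′ s
  PowLe-flip {p} {p′} {s} {s′} h = powLe
    (subst₂ ℕ._≤_ (ℕ.*-comm (2 ^ s) (N ^ p′)) (ℕ.*-comm (N ^ p) (2 ^ s′)) (ℕ.<⇒≤ (ℕ.≰⇒> (h ∘ powLe))))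

  private
    1<2^suc : ∀ j → 1 ℕ.< 2 ^ suc j
    1<2^suc j = ℕ.^-monoʳ-< 2 (s≤s (s≤s z≤n)) {0} {suc j} (s≤s z≤n)

  IntCoeffLe⇔PowLe-split : ∀ a b →
    IntCoeffLe n a b ⇔ PowLe (posPart a) (negPart a) (posPart b) (negPart b)
  IntCoeffLe⇔PowLe-split (+ zero)  (+ j)      = mk⇔
    (λ _ → powLe (subst (1 ℕ.≤_) (sym (ℕ.*-identityʳ (2 ^ j))) (ℕ.m^n>0 2 j)))
    (λ _ → ℤ.+≤+ z≤n)
  IntCoeffLe⇔PowLe-split (+ zero)  -[1+ j ]   = mk⇔ (λ ())
    (λ (powLe h) → ⊥-elim (ℕ.<⇒≱ (1<2^suc j) (subst (ℕ._≤ 1) (ℕ.*-identityˡ _) h)))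
  IntCoeffLe⇔PowLe-split (+ suc k) (+ j)      = mk⇔
    (powLe ∘ subst₂ ℕ._≤_ (sym (ℕ.*-identityʳ _)) (sym (ℕ.*-identityʳ _)))
    (subst₂ ℕ._≤_ (ℕ.*-identityʳ _) (ℕ.*-identityʳ _) ∘ ≤-pow)
  IntCoeffLe⇔PowLe-split (+ suc k) -[1+ j ]   = mk⇔ (λ ())
    (λ (powLe h) → ℕ.<⇒≱ (1<2^suc j) (ℕ.≤-trans (ℕ.m≤n*m (2 ^ suc j) (N ^ suc k) {{ℕ.m^n≢0 N (suc k)}}) h))
  IntCoeffLe⇔PowLe-split -[1+ k ]  (+ j)      = mk⇔
    (λ _ → powLe (ℕ.*-mono-≤ (ℕ.m^n>0 2 j) (ℕ.m^n>0 N (suc k))))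
    (λ _ → tt)
  IntCoeffLe⇔PowLe-split -[1+ k ]  -[1+ j ]   = mk⇔
    (powLe ∘ subst₂ ℕ._≤_ (sym (ℕ.*-identityˡ _)) (sym (ℕ.*-identityˡ _)))
    (subst₂ ℕ._≤_ (ℕ.*-identityˡ _) (ℕ.*-identityˡ _) ∘ ≤-pow)

  IntCoeffLe⇔PowLe : ∀ {a b p p′ s s′} → a ≡ + p ℤ.- + p′ → b ≡ + s ℤ.- + s′ →
                     IntCoeffLe n a b ⇔ PowLe p p′ s s′
  IntCoeffLe⇔PowLe {a} {b} {p} {p′} {s} {s′} ea eb = mk⇔
    (λ h → PowLe-resp (split-unique {posPart a} {negPart a} (trans (sym (split a)) ea))
                      (split-unique {posPart b} {negPart b} (trans (sym (split b)) eb))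
                      (to (IntCoeffLe⇔PowLe-split a b) h))
    (λ h → from (IntCoeffLe⇔PowLe-split a b)
             (PowLe-resp (split-unique {p} {p′} (trans (sym ea) (split a)))
                         (split-unique {s} {s′} (trans (sym eb) (split b))) h))

  IntCoeffLe-+ : ∀ {a b c d} → IntCoeffLe n a b → IntCoeffLe n c d → IntCoeffLe n (a ℤ.+ c) (b ℤ.+ d)
  IntCoeffLe-+ {a} {b} {c} {d} h₁ h₂ = from (IntCoeffLe⇔PowLe (split-+ a c) (split-+ b d))
    (PowLe-+ (to (IntCoeffLe⇔PowLe-split a b) h₁) (to (IntCoeffLe⇔PowLe-split c d) h₂))

  IntCoeffLe-*⇔ : ∀ {a b} k → IntCoeffLe n a b ⇔ IntCoeffLe n (+[1+ k ] ℤ.* a) (+[1+ k ] ℤ.* b)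
  IntCoeffLe-*⇔ {a} {b} k = mk⇔
    (λ h → from scaled (to (PowLe-*⇔ k) (to (IntCoeffLe⇔PowLe-split a b) h)))
    (λ h → from (IntCoeffLe⇔PowLe-split a b) (from (PowLe-*⇔ k) (to scaled h)))
    where
    scaled : IntCoeffLe n (+[1+ k ] ℤ.* a) (+[1+ k ] ℤ.* b) ⇔
             PowLe (posPart a ℕ.* suc k) (negPart a ℕ.* suc k) (posPart b ℕ.* suc k) (negPart b ℕ.* suc k)
    scaled = IntCoeffLe⇔PowLe (split-* (suc k) a) (split-* (suc k) b)

  IntCoeffLe-flip : ∀ {a b} → ¬ IntCoeffLe n a b → IntCoeffLe n (ℤ.- a) (ℤ.- b)
  IntCoeffLe-flip {a} {b} h = from (IntCoeffLe⇔PowLe (split-neg a) (split-neg b))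
    (PowLe-flip (λ h′ → h (from (IntCoeffLe⇔PowLe-split a b) h′)))

  IntCoeffLe? : ∀ a b → Dec (IntCoeffLe n a b)
  IntCoeffLe? a b = map′ (from (IntCoeffLe⇔PowLe-split a b) ∘ powLe) (≤-pow ∘ to (IntCoeffLe⇔PowLe-split a b)) (_ ℕ.≤? _)

  CoeffLeᵘ : ℚᵘ → ℚᵘ → Set
  CoeffLeᵘ u v = IntCoeffLe n (ℚᵘ.↥ u ℤ.* ℚᵘ.↧ v) (ℚᵘ.↥ v ℤ.* ℚᵘ.↧ u)

  CoeffLeᵘ-resp-≃ : ∀ {u u′ v v′} → u ℚᵘ.≃ u′ → v ℚᵘ.≃ v′ → CoeffLeᵘ u v → CoeffLeᵘ u′ v′
  CoeffLeᵘ-resp-≃ {mkℚᵘ a α} {mkℚᵘ a′ α′} {mkℚᵘ b β} {mkℚᵘ b′ β′} (*≡* eu) (*≡* ev) h =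
    from (IntCoeffLe-*⇔ (β ℕ.+ α ℕ.* suc β))
      (subst₂ (IntCoeffLe n) (cross a a′ +[1+ α ] +[1+ α′ ] +[1+ β ] +[1+ β′ ] eu)
                             (cross′ b b′ +[1+ β ] +[1+ β′ ] +[1+ α ] +[1+ α′ ] ev)
        (to (IntCoeffLe-*⇔ (β′ ℕ.+ α′ ℕ.* suc β′)) h))
    where
    open ≡-Reasoning
    cross : ∀ x x′ X X′ Y Y′ → x ℤ.* X′ ≡ x′ ℤ.* X →
            (X′ ℤ.* Y′) ℤ.* (x ℤ.* Y) ≡ (X ℤ.* Y) ℤ.* (x′ ℤ.* Y′)
    cross x x′ X X′ Y Y′ e = begin
      (X′ ℤ.* Y′) ℤ.* (x ℤ.* Y)    ≡⟨ ℤ-Solver.solve (x ∷ X′ ∷ Y ∷ Y′ ∷ []) ⟩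
      (x ℤ.* X′) ℤ.* (Y ℤ.* Y′)    ≡⟨ cong (ℤ._* (Y ℤ.* Y′)) e ⟩
      (x′ ℤ.* X) ℤ.* (Y ℤ.* Y′)    ≡⟨ ℤ-Solver.solve (x′ ∷ X ∷ Y ∷ Y′ ∷ []) ⟩
      (X ℤ.* Y) ℤ.* (x′ ℤ.* Y′)    ∎
    cross′ : ∀ x x′ X X′ Y Y′ → x ℤ.* X′ ≡ x′ ℤ.* X →
             (Y′ ℤ.* X′) ℤ.* (x ℤ.* Y) ≡ (Y ℤ.* X) ℤ.* (x′ ℤ.* Y′)
    cross′ x x′ X X′ Y Y′ e = begin
      (Y′ ℤ.* X′) ℤ.* (x ℤ.* Y)    ≡⟨ ℤ-Solver.solve (x ∷ X′ ∷ Y ∷ Y′ ∷ []) ⟩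
      (x ℤ.* X′) ℤ.* (Y ℤ.* Y′)    ≡⟨ cong (ℤ._* (Y ℤ.* Y′)) e ⟩
      (x′ ℤ.* X) ℤ.* (Y ℤ.* Y′)    ≡⟨ ℤ-Solver.solve (x′ ∷ X ∷ Y ∷ Y′ ∷ []) ⟩
      (Y ℤ.* X) ℤ.* (x′ ℤ.* Y′)    ∎

  CoeffLeᵘ-+ : ∀ {u u′ v v′} → CoeffLeᵘ u v → CoeffLeᵘ u′ v′ → CoeffLeᵘ (u ℚᵘ.+ u′) (v ℚᵘ.+ v′)
  CoeffLeᵘ-+ {mkℚᵘ a α} {mkℚᵘ a′ α′} {mkℚᵘ b β} {mkℚᵘ b′ β′} h₁ h₂ =
    subst₂ (IntCoeffLe n) (sym (sumˡ a a′ +[1+ α ] +[1+ α′ ] +[1+ β ] +[1+ β′ ]))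
                          (sym (sumʳ b b′ +[1+ α ] +[1+ α′ ] +[1+ β ] +[1+ β′ ]))
      (IntCoeffLe-+ (to (IntCoeffLe-*⇔ (β′ ℕ.+ α′ ℕ.* suc β′)) h₁) (to (IntCoeffLe-*⇔ (β ℕ.+ α ℕ.* suc β)) h₂))
    where
    sumˡ : ∀ x x′ X X′ Y Y′ → (x ℤ.* X′ ℤ.+ x′ ℤ.* X) ℤ.* (Y ℤ.* Y′) ≡
                              (X′ ℤ.* Y′) ℤ.* (x ℤ.* Y) ℤ.+ (X ℤ.* Y) ℤ.* (x′ ℤ.* Y′)
    sumˡ = ℤ-Solver.solve-∀
    sumʳ : ∀ y y′ X X′ Y Y′ → (y ℤ.* Y′ ℤ.+ y′ ℤ.* Y) ℤ.* (X ℤ.* X′) ≡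
                              (X′ ℤ.* Y′) ℤ.* (y ℤ.* X) ℤ.+ (X ℤ.* Y) ℤ.* (y′ ℤ.* X′)
    sumʳ = ℤ-Solver.solve-∀

  CoeffLeᵘ-*⇔ : ∀ {u v} γ δ → CoeffLeᵘ u v ⇔ CoeffLeᵘ (mkℚᵘ +[1+ γ ] δ ℚᵘ.* u) (mkℚᵘ +[1+ γ ] δ ℚᵘ.* v)
  CoeffLeᵘ-*⇔ {mkℚᵘ a α} {mkℚᵘ b β} γ δ =
    mk⇔ (subst₂ (IntCoeffLe n) (sym eˡ) (sym eʳ) ∘ to scaled)
        (from scaled ∘ subst₂ (IntCoeffLe n) eˡ eʳ)
    where
    γδ : ℤ
    γδ = +[1+ γ ] ℤ.* +[1+ δ ]
    scaled : IntCoeffLe n (a ℤ.* +[1+ β ]) (b ℤ.* +[1+ α ]) ⇔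
             IntCoeffLe n (γδ ℤ.* (a ℤ.* +[1+ β ])) (γδ ℤ.* (b ℤ.* +[1+ α ]))
    scaled = IntCoeffLe-*⇔ (δ ℕ.+ γ ℕ.* suc δ)
    interchange′ : ∀ g d x y → (g ℤ.* x) ℤ.* (d ℤ.* y) ≡ (g ℤ.* d) ℤ.* (x ℤ.* y)
    interchange′ = ℤ-Solver.solve-∀
    eˡ : (+[1+ γ ] ℤ.* a) ℤ.* (+[1+ δ ] ℤ.* +[1+ β ]) ≡ γδ ℤ.* (a ℤ.* +[1+ β ])
    eˡ = interchange′ +[1+ γ ] +[1+ δ ] a +[1+ β ]
    eʳ : (+[1+ γ ] ℤ.* b) ℤ.* (+[1+ δ ] ℤ.* +[1+ α ]) ≡ γδ ℤ.* (b ℤ.* +[1+ α ])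
    eʳ = interchange′ +[1+ γ ] +[1+ δ ] b +[1+ α ]

  CoeffLeᵘ-flip : ∀ {u v} → ¬ CoeffLeᵘ u v → CoeffLeᵘ (ℚᵘ.- u) (ℚᵘ.- v)
  CoeffLeᵘ-flip {mkℚᵘ a α} {mkℚᵘ b β} h =
    subst₂ (IntCoeffLe n) (ℤ.neg-distribˡ-* a +[1+ β ]) (ℤ.neg-distribˡ-* b +[1+ α ]) (IntCoeffLe-flip h)

  QCoeffLe⇔CoeffLeᵘ : ∀ {q r u v} → toℚᵘ q ℚᵘ.≃ u → toℚᵘ r ℚᵘ.≃ v → QCoeffLe n q r ⇔ CoeffLeᵘ u v
  QCoeffLe⇔CoeffLeᵘ {mkℚ _ _ _} {mkℚ _ _ _} eq er =
    mk⇔ (CoeffLeᵘ-resp-≃ eq er) (CoeffLeᵘ-resp-≃ (ℚᵘ.≃-sym eq) (ℚᵘ.≃-sym er))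

  private
    toCoeffLeᵘ : ∀ q r → QCoeffLe n q r ⇔ CoeffLeᵘ (toℚᵘ q) (toℚᵘ r)
    toCoeffLeᵘ q r = QCoeffLe⇔CoeffLeᵘ {q} {r} ℚᵘ.≃-refl ℚᵘ.≃-refl

  QCoeffLe-+ : ∀ q r q′ r′ → QCoeffLe n q r → QCoeffLe n q′ r′ → QCoeffLe n (q + q′) (r + r′)
  QCoeffLe-+ q r q′ r′ h₁ h₂ =
    from (QCoeffLe⇔CoeffLeᵘ (ℚ.toℚᵘ-homo-+ q q′) (ℚ.toℚᵘ-homo-+ r r′))
      (CoeffLeᵘ-+ {toℚᵘ q} {toℚᵘ q′} {toℚᵘ r} {toℚᵘ r′} (to (toCoeffLeᵘ q r) h₁) (to (toCoeffLeᵘ q′ r′) h₂))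

  QCoeffLe-*⇔ : ∀ {c} q r → 0ℚ < c → QCoeffLe n q r ⇔ QCoeffLe n (c * q) (c * r)
  QCoeffLe-*⇔ {c} q r 0<c = scale c {{ℚ.positive 0<c}}
    where
    scale : ∀ c .{{_ : ℚ.Positive c}} → QCoeffLe n q r ⇔ QCoeffLe n (c * q) (c * r)
    scale c@(mkℚ +[1+ γ ] δ _) = mk⇔
      (from tr ∘ to (CoeffLeᵘ-*⇔ {toℚᵘ q} {toℚᵘ r} γ δ) ∘ to (toCoeffLeᵘ q r))
      (from (toCoeffLeᵘ q r) ∘ from (CoeffLeᵘ-*⇔ {toℚᵘ q} {toℚᵘ r} γ δ) ∘ to tr)
      where
      tr : QCoeffLe n (c * q) (c * r) ⇔ CoeffLeᵘ (toℚᵘ c ℚᵘ.* toℚᵘ q) (toℚᵘ c ℚᵘ.* toℚᵘ r)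
      tr = QCoeffLe⇔CoeffLeᵘ (ℚ.toℚᵘ-homo-* c q) (ℚ.toℚᵘ-homo-* c r)

  QCoeffLe-flip : ∀ q r → ¬ QCoeffLe n q r → QCoeffLe n (- q) (- r)
  QCoeffLe-flip q r h = from (QCoeffLe⇔CoeffLeᵘ (ℚ.toℚᵘ-homo‿- q) (ℚ.toℚᵘ-homo‿- r))
    (CoeffLeᵘ-flip {toℚᵘ q} {toℚᵘ r} (h ∘ from (toCoeffLeᵘ q r)))

  QCoeffLe-0 : ∀ {r} → 0ℚ ≤ r → QCoeffLe n 0ℚ r
  QCoeffLe-0 (ℚ.*≤* h) = h

  QCoeffLe? : ∀ q r → Dec (QCoeffLe n q r)
  QCoeffLe? q r = IntCoeffLe? _ _

  ≤[]-refl : ∀ x → x ≤[ n ] x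
  ≤[]-refl ⟨ k , c ⟩ = subst₂ (QCoeffLe n) (sym (ℚ.+-inverseʳ c)) (sym (ℚ.+-inverseʳ k)) (QCoeffLe-0 ℚ.≤-refl)

  ≤[]-trans : ∀ x y z → x ≤[ n ] y → y ≤[ n ] z → x ≤[ n ] z
  ≤[]-trans ⟨ kx , cx ⟩ ⟨ ky , cy ⟩ ⟨ kz , cz ⟩ h₁ h₂ =
    subst₂ (QCoeffLe n) (telescope cx cy cz) (telescope′ kx ky kz)
      (QCoeffLe-+ (cx - cy) (ky - kx) (cy - cz) (kz - ky) h₁ h₂)
    where
    telescope : ∀ a b c → (a - b) + (b - c) ≡ a - c
    telescope = solve-∀ ℚ-ring
    telescope′ : ∀ a b c → (b - a) + (c - b) ≡ c - a
    telescope′ = solve-∀ ℚ-ring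

  ≤[]-total : ∀ x y → ¬ (y ≤[ n ] x) → x ≤[ n ] y
  ≤[]-total ⟨ kx , cx ⟩ ⟨ ky , cy ⟩ h =
    subst₂ (QCoeffLe n) (swap cy cx) (swap kx ky) (QCoeffLe-flip (cy - cx) (kx - ky) h)
    where
    swap : ∀ a b → - (a - b) ≡ b - a
    swap = solve-∀ ℚ-ring

  ≤[]? : ∀ x y → Dec (x ≤[ n ] y)
  ≤[]? x y = QCoeffLe? (coeff x - coeff y) (const y - const x)

_·b[_]≤_ : ℚ → ℕ → ℚ → Set
q ·b[ n ]≤ r = (q ⊛ b n) ≤[ n ] ofℚ r

module _ (n : ℕ) where

  private
    λₙ : ℚ
    λₙ = 1ℚ + frac 1 n

  ·b≤-*⇔ : ∀ {c} q r → 0ℚ < c → q ·b[ n ]≤ r ⇔ (c * q) ·b[ n ]≤ (c * r)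
  ·b≤-*⇔ {c} q r 0<c = mk⇔
    (subst₂ (QCoeffLe n) (coeffs c q λₙ) (consts c q r) ∘ to scaled)
    (from scaled ∘ subst₂ (QCoeffLe n) (sym (coeffs c q λₙ)) (sym (consts c q r)))
    where
    scaled : q ·b[ n ]≤ r ⇔ QCoeffLe n (c * (q * λₙ - 0ℚ)) (c * (r - q * - 1ℚ))
    scaled = QCoeffLe-*⇔ n (q * λₙ - 0ℚ) (r - q * - 1ℚ) 0<c
    coeffs : ∀ c q l → c * (q * l - 0ℚ) ≡ c * q * l - 0ℚ
    coeffs = solve-∀ ℚ-ring
    consts : ∀ c q r → c * (r - q * - 1ℚ) ≡ c * r - c * q * - 1ℚ
    consts = solve-∀ ℚ-ring

  ·b≤-weaken : ∀ q {r r′} → r ≤ r′ → q ·b[ n ]≤ r → q ·b[ n ]≤ r′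
  ·b≤-weaken q {r} {r′} r≤r′ h =
    subst₂ (QCoeffLe n) (ℚ.+-identityʳ (q * λₙ - 0ℚ)) (shift q r r′)
      (QCoeffLe-+ n (q * λₙ - 0ℚ) (r - q * - 1ℚ) 0ℚ (r′ - r) h (QCoeffLe-0 n (p≤q⇒0≤q-p r≤r′)))
    where
    shift : ∀ q r r′ → r - q * - 1ℚ + (r′ - r) ≡ r′ - q * - 1ℚ
    shift = solve-∀ ℚ-ring

  ·b≤-ratio : ∀ {q q′} r r′ → 0ℚ < q → 0ℚ < q′ → r * q′ ≤ r′ * q → q ·b[ n ]≤ r → q′ ·b[ n ]≤ r′
  ·b≤-ratio {q} {q′} r r′ 0<q 0<q′ cross h =
    from (·b≤-*⇔ q′ r′ 0<q)
      (subst (λ c → c ·b[ n ]≤ (q * r′)) (ℚ.*-comm q′ q)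
        (·b≤-weaken (q′ * q) (subst₂ _≤_ (ℚ.*-comm r q′) (ℚ.*-comm r′ q) cross)
          (to (·b≤-*⇔ q r 0<q′) h)))

·b≤⇔pow : ∀ {n} a → 0 ℕ.< n →
          (ℕtoℚ 3 ·b[ n ]≤ frac a 2) ⇔ (suc n ^ (6 ℕ.* suc n) ℕ.≤ 2 ^ ((a ℕ.+ 6) ℕ.* n))
·b≤⇔pow {n@(suc k)} a 0<n = mk⇔ (unwrap ∘ to powers ∘ to cleared) (from cleared ∘ from powers ∘ wrap)
  where
  open ≡-Reasoning
  toℚᵘ-frac : ∀ {q} x d → q ≡ frac x (suc d) → toℚᵘ q ℚᵘ.≃ mkℚᵘ (+ x) d
  toℚᵘ-frac x d refl = ℚ.toℚᵘ-fromℚᵘ (mkℚᵘ (+ x) d)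

  coeff≡ : ℕtoℚ 3 * (1ℚ + frac 1 n) - 0ℚ ≡ frac (3 ℕ.* suc n) n
  coeff≡ = frac-unique (3 ℕ.* suc n) 0<n (begin
    (ℕtoℚ 3 * (1ℚ + frac 1 n) - 0ℚ) * ℕtoℚ n   ≡⟨ expand (ℕtoℚ 3) (frac 1 n) (ℕtoℚ n) ⟩
    ℕtoℚ 3 * (1ℚ + ℕtoℚ n) + ℕtoℚ 3 * (frac 1 n * ℕtoℚ n - 1ℚ)
      ≡⟨ cong (λ t → ℕtoℚ 3 * (1ℚ + ℕtoℚ n) + ℕtoℚ 3 * (t - 1ℚ)) (frac-*-cancel 1 0<n) ⟩
    ℕtoℚ 3 * (1ℚ + ℕtoℚ n) + ℕtoℚ 3 * (1ℚ - 1ℚ)  ≡⟨ drop (ℕtoℚ 3) (1ℚ + ℕtoℚ n) ⟩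
    ℕtoℚ 3 * (1ℚ + ℕtoℚ n)                      ≡⟨ sym (trans (ℕtoℚ-* 3 (suc n)) (cong (ℕtoℚ 3 *_) (ℕtoℚ-suc n))) ⟩
    ℕtoℚ (3 ℕ.* suc n)                          ∎)
    where
    expand : ∀ t u N → (t * (1ℚ + u) - 0ℚ) * N ≡ t * (1ℚ + N) + t * (u * N - 1ℚ)
    expand = solve-∀ ℚ-ring
    drop : ∀ t x → t * x + t * (1ℚ - 1ℚ) ≡ t * x
    drop = solve-∀ ℚ-ring

  const≡ : frac a 2 - ℕtoℚ 3 * - 1ℚ ≡ frac (a ℕ.+ 6) 2
  const≡ = frac-unique (a ℕ.+ 6) (s≤s z≤n) (begin
    (frac a 2 - ℕtoℚ 3 * - 1ℚ) * ℕtoℚ 2   ≡⟨ expand (frac a 2) ⟩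
    frac a 2 * ℕtoℚ 2 + ℕtoℚ 6            ≡⟨ cong (_+ ℕtoℚ 6) (frac-*-cancel a (s≤s z≤n)) ⟩
    ℕtoℚ a + ℕtoℚ 6                       ≡⟨ sym (ℕtoℚ-+ a 6) ⟩
    ℕtoℚ (a ℕ.+ 6)                        ∎)
    where
    expand : ∀ x → (x - ℕtoℚ 3 * - 1ℚ) * ℕtoℚ 2 ≡ x * ℕtoℚ 2 + ℕtoℚ 6
    expand = solve-∀ ℚ-ring

  cleared : ℕtoℚ 3 ·b[ n ]≤ frac a 2 ⇔ CoeffLeᵘ n (mkℚᵘ (+ (3 ℕ.* suc n)) k) (mkℚᵘ (+ (a ℕ.+ 6)) 1)
  cleared = QCoeffLe⇔CoeffLeᵘ n (toℚᵘ-frac (3 ℕ.* suc n) k coeff≡) (toℚᵘ-frac (a ℕ.+ 6) 1 const≡)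

  powers : IntCoeffLe n (+ (3 ℕ.* suc n) ℤ.* + 2) (+ (a ℕ.+ 6) ℤ.* + n) ⇔
           PowLe n (6 ℕ.* suc n) 0 ((a ℕ.+ 6) ℕ.* n) 0
  powers = IntCoeffLe⇔PowLe n
    (trans (sym (ℤ.pos-* (3 ℕ.* suc n) 2))
      (trans (cong +_ (trans (ℕ.*-comm (3 ℕ.* suc n) 2) (sym (ℕ.*-assoc 2 3 (suc n))))) (sym (ℤ.+-identityʳ _))))
    (trans (sym (ℤ.pos-* (a ℕ.+ 6) n)) (sym (ℤ.+-identityʳ _)))

  unwrap : PowLe n (6 ℕ.* suc n) 0 ((a ℕ.+ 6) ℕ.* n) 0 → suc n ^ (6 ℕ.* suc n) ℕ.≤ 2 ^ ((a ℕ.+ 6) ℕ.* n)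
  unwrap (powLe h) = subst₂ ℕ._≤_ (ℕ.*-identityʳ _) (ℕ.*-identityʳ _) h

  wrap : suc n ^ (6 ℕ.* suc n) ℕ.≤ 2 ^ ((a ℕ.+ 6) ℕ.* n) → PowLe n (6 ℕ.* suc n) 0 ((a ℕ.+ 6) ℕ.* n) 0
  wrap h = powLe (subst₂ ℕ._≤_ (sym (ℕ.*-identityʳ _)) (sym (ℕ.*-identityʳ _)) h)

-- The gaps Δ and Γ

module _ (n : ℕ) where

  x e ρ : ℕ → ℚ
  x j = frac 1 (n ℕ.∸ j)
  e j = frac n (n ℕ.∸ j)
  ρ j = frac (suc j) 2 * frac j (n ℕ.∸ j)

  E≡∑ : ∀ m → E n m ≡ ∑[ j < m ] e j
  E≡∑ = sumℚ-applyUpTo e (λ j → j)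

  R≡∑ : ∀ m → R n m ≡ ∑[ j < m ] ρ j
  R≡∑ zero    = refl
  R≡∑ (suc m) = begin
    R n (suc m)                      ≡⟨ sumℚ-applyUpTo ρ suc m ⟩
    ∑[ j < m ] ρ (suc j)             ≡⟨ sym (ℚ.+-identityˡ _) ⟩
    0ℚ + ∑[ j < m ] ρ (suc j)        ≡⟨ cong (_+ ∑[ j < m ] ρ (suc j)) (sym ρ₀) ⟩
    ρ 0 + ∑[ j < m ] ρ (suc j)       ≡⟨ sym (∑-front ρ m) ⟩
    ∑[ j < suc m ] ρ j               ∎
    where
    open ≡-Reasoning
    ρ₀ : ρ 0 ≡ 0ℚ
    ρ₀ = trans (cong (λ t → frac 1 2 * t) (frac-zero n)) (ℚ.*-zeroʳ (frac 1 2))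

  Δ Γ : ℕ → ℚ
  Δ m = ℕtoℚ m * e m - E n m
  Γ m = ρ m * E n m - R n m * e m

  module _ {j : ℕ} (j<n : j ℕ.< n) where

    private
      0<n∸j : 0 ℕ.< n ℕ.∸ j
      0<n∸j = ℕ.m<n⇒0<n∸m j<n

    x-pos : 0ℚ < x j
    x-pos = frac-pos (s≤s z≤n) 0<n∸j

    x-inv : x j * (ℕtoℚ n - ℕtoℚ j) ≡ 1ℚ
    x-inv = trans (cong (λ t → x j * t) (sym (ℕtoℚ-∸ (ℕ.<⇒≤ j<n)))) (frac-*-cancel 1 0<n∸j)

    e≡ : e j ≡ ℕtoℚ n * x j
    e≡ = frac-split n 0<n∸j

    ρ≡ : ρ j ≡ (1ℚ + ℕtoℚ j) * ½ * (ℕtoℚ j * x j)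
    ρ≡ = cong₂ _*_ (trans (frac-split (suc j) (s≤s z≤n)) (cong (_* ½) (ℕtoℚ-suc j))) (frac-split j 0<n∸j)

  module _ {m : ℕ} (m<n : m ℕ.< n) where

    private
      N M y : ℚ
      N = ℕtoℚ n
      M = ℕtoℚ m
      y = x m

    x-gap : ∀ {j} → j ℕ.< m → y - x j ≡ y * (x j * (M - ℕtoℚ j))
    x-gap {j} j<m = begin
      y - x j                                              ≡⟨ pad y (x j) ⟩
      y * 1ℚ - x j * 1ℚ                                    ≡⟨ cong₂ (λ u v → y * u - x j * v) (sym (x-inv j<n)) (sym (x-inv m<n)) ⟩
      y * (x j * (N - J)) - x j * (y * (N - M))            ≡⟨ collect N M J (x j) y ⟩
      y * (x j * (M - J))                                  ∎
      where
      open ≡-Reasoning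
      j<n : j ℕ.< n
      j<n = ℕ.<-trans j<m m<n
      J : ℚ
      J = ℕtoℚ j
      pad : ∀ a b → a - b ≡ a * 1ℚ - b * 1ℚ
      pad = solve-∀ ℚ-ring
      collect : ∀ N M J xj y → y * (xj * (N - J)) - xj * (y * (N - M)) ≡ y * (xj * (M - J))
      collect = solve-∀ ℚ-ring

    e-gap : ∀ {j} → j ℕ.< m → e m - e j ≡ N * y * (x j * (M - ℕtoℚ j))
    e-gap {j} j<m = begin
      e m - e j                       ≡⟨ cong₂ _-_ (e≡ m<n) (e≡ (ℕ.<-trans j<m m<n)) ⟩
      N * y - N * x j                 ≡⟨ factor N y (x j) ⟩
      N * (y - x j)                   ≡⟨ cong (λ t → N * t) (x-gap j<m) ⟩
      N * (y * (x j * (M - ℕtoℚ j)))  ≡⟨ sym (ℚ.*-assoc N y _) ⟩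
      N * y * (x j * (M - ℕtoℚ j))    ∎
      where
      open ≡-Reasoning
      factor : ∀ N a b → N * a - N * b ≡ N * (a - b)
      factor = solve-∀ ℚ-ring

    ρe-gap : ∀ {j} → j ℕ.< m → ρ m * e j - ρ j * e m ≡ ½ * (M + ℕtoℚ j + 1ℚ) * (e m - e j)
    ρe-gap {j} j<m = begin
      ρ m * e j - ρ j * e m
        ≡⟨ cong₂ _-_ (cong₂ _*_ (ρ≡ m<n) (e≡ j<n)) (cong₂ _*_ (ρ≡ j<n) (e≡ m<n)) ⟩
      (1ℚ + M) * ½ * (M * y) * (N * x j) - (1ℚ + J) * ½ * (J * x j) * (N * y)
        ≡⟨ factor N M J (x j) y ⟩
      ½ * (M + J + 1ℚ) * (N * y * (x j * (M - J)))
        ≡⟨ cong (λ t → ½ * (M + J + 1ℚ) * t) (sym (e-gap j<m)) ⟩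
      ½ * (M + J + 1ℚ) * (e m - e j)                      ∎
      where
      open ≡-Reasoning
      j<n : j ℕ.< n
      j<n = ℕ.<-trans j<m m<n
      J : ℚ
      J = ℕtoℚ j
      factor : ∀ N M J xj y → (1ℚ + M) * ½ * (M * y) * (N * xj) - (1ℚ + J) * ½ * (J * xj) * (N * y) ≡
                              ½ * (M + J + 1ℚ) * (N * y * (xj * (M - J)))
      factor = solve-∀ ℚ-ring

    Δ≡∑ : Δ m ≡ ∑[ j < m ] (e m - e j)
    Δ≡∑ = begin
      M * e m - E n m                                     ≡⟨ cong (λ s → M * e m - s) (E≡∑ m) ⟩
      M * e m - ∑[ j < m ] e j                            ≡⟨ rearrange M (e m) _ ⟩
      e m * M + - 1ℚ * ∑[ j < m ] e j                     ≡⟨ cong (_+ - 1ℚ * ∑[ j < m ] e j) (sym (∑-const (e m) m)) ⟩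
      ∑[ j < m ] e m + - 1ℚ * ∑[ j < m ] e j              ≡⟨ cong (_+ - 1ℚ * ∑[ j < m ] e j) (sym (ℚ.*-identityˡ (∑[ j < m ] e m))) ⟩
      1ℚ * ∑[ j < m ] e m + - 1ℚ * ∑[ j < m ] e j         ≡⟨ sym (∑-linear 1ℚ (- 1ℚ) (λ _ → e m) e m) ⟩
      ∑[ j < m ] (1ℚ * e m + - 1ℚ * e j)                  ≡⟨ ∑-cong m (λ j _ → simplify (e m) (e j)) ⟩
      ∑[ j < m ] (e m - e j)                              ∎
      where
      open ≡-Reasoning
      rearrange : ∀ M a S → M * a - S ≡ a * M + - 1ℚ * S
      rearrange = solve-∀ ℚ-ring
      simplify : ∀ a b → 1ℚ * a + - 1ℚ * b ≡ a - b
      simplify = solve-∀ ℚ-ring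

    Γ≡∑ : Γ m ≡ ∑[ j < m ] (ρ m * e j - ρ j * e m)
    Γ≡∑ = begin
      ρ m * E n m - R n m * e m                           ≡⟨ cong₂ (λ s t → ρ m * s - t * e m) (E≡∑ m) (R≡∑ m) ⟩
      ρ m * ∑[ j < m ] e j - ∑[ j < m ] ρ j * e m         ≡⟨ rearrange (ρ m) (e m) _ _ ⟩
      ρ m * ∑[ j < m ] e j + - e m * ∑[ j < m ] ρ j       ≡⟨ sym (∑-linear (ρ m) (- e m) e ρ m) ⟩
      ∑[ j < m ] (ρ m * e j + - e m * ρ j)                ≡⟨ ∑-cong m (λ j _ → rearrange′ (ρ m) (e m) (e j) (ρ j)) ⟩
      ∑[ j < m ] (ρ m * e j - ρ j * e m)                  ∎
      where
      open ≡-Reasoning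
      rearrange : ∀ r a S T → r * S - T * a ≡ r * S + - a * T
      rearrange = solve-∀ ℚ-ring
      rearrange′ : ∀ r a b s → r * b + - a * s ≡ r * b - s * a
      rearrange′ = solve-∀ ℚ-ring

    W : ℚ → ℚ
    W c = ∑[ j < m ] (x j * (M - ℕtoℚ j) * (ℕtoℚ 3 * ℕtoℚ j + c))

    Γ-Δ-combination : ∀ α β → α * Γ m + β * Δ m ≡
      ½ * N * y * ∑[ j < m ] (x j * (M - ℕtoℚ j) * (α * (M + ℕtoℚ j + 1ℚ) + (β + β)))
    Γ-Δ-combination α β = begin
      α * Γ m + β * Δ m
        ≡⟨ cong₂ (λ s t → α * s + β * t) Γ≡∑ Δ≡∑ ⟩
      α * ∑[ j < m ] (ρ m * e j - ρ j * e m) + β * ∑[ j < m ] (e m - e j)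
        ≡⟨ sym (∑-linear α β (λ j → ρ m * e j - ρ j * e m) (λ j → e m - e j) m) ⟩
      ∑[ j < m ] (α * (ρ m * e j - ρ j * e m) + β * (e m - e j))
        ≡⟨ ∑-cong m (λ j j<m → pointwise j<m) ⟩
      ∑[ j < m ] (½ * N * y * (x j * (M - ℕtoℚ j) * (α * (M + ℕtoℚ j + 1ℚ) + (β + β))))
        ≡⟨ ∑-scale (½ * N * y) _ m ⟩
      ½ * N * y * ∑[ j < m ] (x j * (M - ℕtoℚ j) * (α * (M + ℕtoℚ j + 1ℚ) + (β + β)))  ∎
      where
      open ≡-Reasoning
      pointwise : ∀ {j} → j ℕ.< m → α * (ρ m * e j - ρ j * e m) + β * (e m - e j) ≡
                  ½ * N * y * (x j * (M - ℕtoℚ j) * (α * (M + ℕtoℚ j + 1ℚ) + (β + β)))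
      pointwise {j} j<m = begin
        α * (ρ m * e j - ρ j * e m) + β * (e m - e j)
          ≡⟨ cong (λ t → α * t + β * (e m - e j)) (ρe-gap j<m) ⟩
        α * (½ * (M + ℕtoℚ j + 1ℚ) * (e m - e j)) + β * (e m - e j)
          ≡⟨ cong (λ t → α * (½ * (M + ℕtoℚ j + 1ℚ) * t) + β * t) (e-gap j<m) ⟩
        α * (½ * (M + ℕtoℚ j + 1ℚ) * (N * y * (x j * (M - ℕtoℚ j)))) + β * (N * y * (x j * (M - ℕtoℚ j)))
          ≡⟨ regroup α β N M (ℕtoℚ j) (x j) y ⟩
        ½ * N * y * (x j * (M - ℕtoℚ j) * (α * (M + ℕtoℚ j + 1ℚ) + (β + β)))  ∎
        where
        regroup : ∀ α β N M J xj y →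
          α * (½ * (M + J + 1ℚ) * (N * y * (xj * (M - J)))) + β * (N * y * (xj * (M - J))) ≡
          ½ * N * y * (xj * (M - J) * (α * (M + J + 1ℚ) + (β + β)))
        regroup = solve-∀ ℚ-ring

    -- termwise, x j (n − j) = 1 gives (3n + c) x j = 3 + (3j + c) x j
    W-identity : ∀ c → (ℕtoℚ 3 * N + c) * W c ≡
      ℕtoℚ 3 * ∑[ j < m ] ((M - ℕtoℚ j) * (ℕtoℚ 3 * ℕtoℚ j + c))
      + ∑[ j < m ] (x j * (M - ℕtoℚ j) * (ℕtoℚ 3 * ℕtoℚ j + c) * (ℕtoℚ 3 * ℕtoℚ j + c))
    W-identity c = begin
      (ℕtoℚ 3 * N + c) * W c
        ≡⟨ sym (∑-scale (ℕtoℚ 3 * N + c) _ m) ⟩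
      ∑[ j < m ] ((ℕtoℚ 3 * N + c) * (x j * (M - ℕtoℚ j) * (ℕtoℚ 3 * ℕtoℚ j + c)))
        ≡⟨ ∑-cong m (λ j j<m → pointwise (ℕ.<-trans j<m m<n)) ⟩
      ∑[ j < m ] (ℕtoℚ 3 * ((M - ℕtoℚ j) * (ℕtoℚ 3 * ℕtoℚ j + c))
                   + 1ℚ * (x j * (M - ℕtoℚ j) * (ℕtoℚ 3 * ℕtoℚ j + c) * (ℕtoℚ 3 * ℕtoℚ j + c)))
        ≡⟨ ∑-linear (ℕtoℚ 3) 1ℚ _ _ m ⟩
      ℕtoℚ 3 * ∑[ j < m ] ((M - ℕtoℚ j) * (ℕtoℚ 3 * ℕtoℚ j + c))
      + 1ℚ * ∑[ j < m ] (x j * (M - ℕtoℚ j) * (ℕtoℚ 3 * ℕtoℚ j + c) * (ℕtoℚ 3 * ℕtoℚ j + c))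
        ≡⟨ cong (λ t → ℕtoℚ 3 * ∑[ j < m ] ((M - ℕtoℚ j) * (ℕtoℚ 3 * ℕtoℚ j + c)) + t) (ℚ.*-identityˡ _) ⟩
      ℕtoℚ 3 * ∑[ j < m ] ((M - ℕtoℚ j) * (ℕtoℚ 3 * ℕtoℚ j + c))
      + ∑[ j < m ] (x j * (M - ℕtoℚ j) * (ℕtoℚ 3 * ℕtoℚ j + c) * (ℕtoℚ 3 * ℕtoℚ j + c))  ∎
      where
      open ≡-Reasoning
      pointwise : ∀ {j} → j ℕ.< n →
        (ℕtoℚ 3 * N + c) * (x j * (M - ℕtoℚ j) * (ℕtoℚ 3 * ℕtoℚ j + c)) ≡
        ℕtoℚ 3 * ((M - ℕtoℚ j) * (ℕtoℚ 3 * ℕtoℚ j + c))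
        + 1ℚ * (x j * (M - ℕtoℚ j) * (ℕtoℚ 3 * ℕtoℚ j + c) * (ℕtoℚ 3 * ℕtoℚ j + c))
      pointwise {j} j<n = begin
        (ℕtoℚ 3 * N + c) * (x j * (M - ℕtoℚ j) * (ℕtoℚ 3 * ℕtoℚ j + c))
          ≡⟨ distribute N M (ℕtoℚ j) (x j) c ⟩
        ℕtoℚ 3 * (x j * (N - ℕtoℚ j)) * ((M - ℕtoℚ j) * (ℕtoℚ 3 * ℕtoℚ j + c))
        + 1ℚ * (x j * (M - ℕtoℚ j) * (ℕtoℚ 3 * ℕtoℚ j + c) * (ℕtoℚ 3 * ℕtoℚ j + c))
          ≡⟨ cong (λ t → ℕtoℚ 3 * t * ((M - ℕtoℚ j) * (ℕtoℚ 3 * ℕtoℚ j + c))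
                         + 1ℚ * (x j * (M - ℕtoℚ j) * (ℕtoℚ 3 * ℕtoℚ j + c) * (ℕtoℚ 3 * ℕtoℚ j + c))) (x-inv j<n) ⟩
        ℕtoℚ 3 * 1ℚ * ((M - ℕtoℚ j) * (ℕtoℚ 3 * ℕtoℚ j + c))
        + 1ℚ * (x j * (M - ℕtoℚ j) * (ℕtoℚ 3 * ℕtoℚ j + c) * (ℕtoℚ 3 * ℕtoℚ j + c))
          ≡⟨ cong (_+ 1ℚ * (x j * (M - ℕtoℚ j) * (ℕtoℚ 3 * ℕtoℚ j + c) * (ℕtoℚ 3 * ℕtoℚ j + c)))
                  (cong (_* ((M - ℕtoℚ j) * (ℕtoℚ 3 * ℕtoℚ j + c))) (ℚ.*-identityʳ (ℕtoℚ 3))) ⟩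
        ℕtoℚ 3 * ((M - ℕtoℚ j) * (ℕtoℚ 3 * ℕtoℚ j + c))
        + 1ℚ * (x j * (M - ℕtoℚ j) * (ℕtoℚ 3 * ℕtoℚ j + c) * (ℕtoℚ 3 * ℕtoℚ j + c))  ∎
        where
        distribute : ∀ N M J xj c →
          (ℕtoℚ 3 * N + c) * (xj * (M - J) * (ℕtoℚ 3 * J + c)) ≡
          ℕtoℚ 3 * (xj * (N - J)) * ((M - J) * (ℕtoℚ 3 * J + c))
          + 1ℚ * (xj * (M - J) * (ℕtoℚ 3 * J + c) * (ℕtoℚ 3 * J + c))
        distribute = solve-∀ ℚ-ring

    ∑-linear-weight : ∀ c → ∑[ j < m ] ((M - ℕtoℚ j) * (ℕtoℚ 3 * ℕtoℚ j + c)) ≡ ½ * M * (M + 1ℚ) * (M - 1ℚ + c)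
    ∑-linear-weight c = begin
      ∑[ j < m ] ((M - ℕtoℚ j) * (ℕtoℚ 3 * ℕtoℚ j + c))
        ≡⟨ ∑-cong m (λ j _ → expand M (ℕtoℚ j) c) ⟩
      ∑[ j < m ] (c * M + (ℕtoℚ 3 * M - c) * ℕtoℚ j + - ℕtoℚ 3 * ℕtoℚ j * ℕtoℚ j + 0ℚ * ℕtoℚ j * ℕtoℚ j * ℕtoℚ j)
        ≡⟨ ∑-cubic (c * M) (ℕtoℚ 3 * M - c) (- ℕtoℚ 3) 0ℚ m ⟩
      c * M * M + (ℕtoℚ 3 * M - c) * ½ * M * (M - 1ℚ) + - ℕtoℚ 3 * ⅙ * M * (M - 1ℚ) * (M + M - 1ℚ)
        + 0ℚ * ¼ * M * M * (M - 1ℚ) * (M - 1ℚ)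
        ≡⟨ closed M c ⟩
      ½ * M * (M + 1ℚ) * (M - 1ℚ + c)  ∎
      where
      open ≡-Reasoning
      expand : ∀ M J c → (M - J) * (ℕtoℚ 3 * J + c) ≡
               c * M + (ℕtoℚ 3 * M - c) * J + - ℕtoℚ 3 * J * J + 0ℚ * J * J * J
      expand = solve-∀ ℚ-ring
      closed : ∀ M c → c * M * M + (ℕtoℚ 3 * M - c) * ½ * M * (M - 1ℚ) + - ℕtoℚ 3 * ⅙ * M * (M - 1ℚ) * (M + M - 1ℚ)
                       + 0ℚ * ¼ * M * M * (M - 1ℚ) * (M - 1ℚ) ≡ ½ * M * (M + 1ℚ) * (M - 1ℚ + c)
      closed = solve-∀ ℚ-ring

    ∑-square-weight : ∀ c → ∑[ j < m ] ((M - ℕtoℚ j) * (ℕtoℚ 3 * ℕtoℚ j + c) * (ℕtoℚ 3 * ℕtoℚ j + c)) ≡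
      ¼ * M * (M + 1ℚ) * (ℕtoℚ 3 * M * (M - 1ℚ) + ℕtoℚ 4 * c * (M - 1ℚ) + ℕtoℚ 2 * c * c)
    ∑-square-weight c = begin
      ∑[ j < m ] ((M - ℕtoℚ j) * (ℕtoℚ 3 * ℕtoℚ j + c) * (ℕtoℚ 3 * ℕtoℚ j + c))
        ≡⟨ ∑-cong m (λ j _ → expand M (ℕtoℚ j) c) ⟩
      ∑[ j < m ] (c * c * M + (ℕtoℚ 6 * c * M - c * c) * ℕtoℚ j + (ℕtoℚ 9 * M - ℕtoℚ 6 * c) * ℕtoℚ j * ℕtoℚ j
                  + - ℕtoℚ 9 * ℕtoℚ j * ℕtoℚ j * ℕtoℚ j)
        ≡⟨ ∑-cubic (c * c * M) (ℕtoℚ 6 * c * M - c * c) (ℕtoℚ 9 * M - ℕtoℚ 6 * c) (- ℕtoℚ 9) m ⟩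
      c * c * M * M + (ℕtoℚ 6 * c * M - c * c) * ½ * M * (M - 1ℚ)
        + (ℕtoℚ 9 * M - ℕtoℚ 6 * c) * ⅙ * M * (M - 1ℚ) * (M + M - 1ℚ)
        + - ℕtoℚ 9 * ¼ * M * M * (M - 1ℚ) * (M - 1ℚ)
        ≡⟨ closed M c ⟩
      ¼ * M * (M + 1ℚ) * (ℕtoℚ 3 * M * (M - 1ℚ) + ℕtoℚ 4 * c * (M - 1ℚ) + ℕtoℚ 2 * c * c)  ∎
      where
      open ≡-Reasoning
      expand : ∀ M J c → (M - J) * (ℕtoℚ 3 * J + c) * (ℕtoℚ 3 * J + c) ≡
               c * c * M + (ℕtoℚ 6 * c * M - c * c) * J + (ℕtoℚ 9 * M - ℕtoℚ 6 * c) * J * J + - ℕtoℚ 9 * J * J * J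
      expand = solve-∀ ℚ-ring
      closed : ∀ M c → c * c * M * M + (ℕtoℚ 6 * c * M - c * c) * ½ * M * (M - 1ℚ)
                       + (ℕtoℚ 9 * M - ℕtoℚ 6 * c) * ⅙ * M * (M - 1ℚ) * (M + M - 1ℚ)
                       + - ℕtoℚ 9 * ¼ * M * M * (M - 1ℚ) * (M - 1ℚ) ≡
                       ¼ * M * (M + 1ℚ) * (ℕtoℚ 3 * M * (M - 1ℚ) + ℕtoℚ 4 * c * (M - 1ℚ) + ℕtoℚ 2 * c * c)
      closed = solve-∀ ℚ-ring

    private
      M-J-nonNeg : ∀ {j} → j ℕ.< m → 0ℚ ≤ M - ℕtoℚ j
      M-J-nonNeg {j} j<m = subst (0ℚ ≤_) (ℕtoℚ-∸ (ℕ.<⇒≤ j<m)) (ℕtoℚ-nonNeg (m ℕ.∸ j))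

      x≤y : ∀ {j} → j ℕ.< m → x j ≤ y
      x≤y j<m = 0≤q-p⇒p≤q (subst (0ℚ ≤_) (sym (x-gap j<m))
        (*-nonNeg (ℚ.<⇒≤ (x-pos m<n)) (*-nonNeg (ℚ.<⇒≤ (x-pos (ℕ.<-trans j<m m<n))) (M-J-nonNeg j<m))))

      ½Ny-pos : 0ℚ < ½ * N * y
      ½Ny-pos = *-pos (*-pos (frac-pos {1} {2} (s≤s z≤n) (s≤s z≤n)) (ℕtoℚ-pos (ℕ.≤-<-trans z≤n m<n))) (x-pos m<n)

      square-weight-nonNeg : ∀ {j} c → j ℕ.< m → 0ℚ ≤ (M - ℕtoℚ j) * (ℕtoℚ 3 * ℕtoℚ j + c) * (ℕtoℚ 3 * ℕtoℚ j + c)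
      square-weight-nonNeg {j} c j<m = subst (0ℚ ≤_) (sym (ℚ.*-assoc (M - ℕtoℚ j) (ℕtoℚ 3 * ℕtoℚ j + c) (ℕtoℚ 3 * ℕtoℚ j + c)))
        (*-nonNeg (M-J-nonNeg j<m) (square-nonNeg (ℕtoℚ 3 * ℕtoℚ j + c)))

    W-nonNeg : 0ℚ ≤ W (1ℚ - M)
    W-nonNeg = nonNeg-cancelˡ K-pos (subst (0ℚ ≤_) (sym KW≡) (∑-nonNeg m S₂-term-nonNeg))
      where
      open ≡-Reasoning
      c : ℚ
      c = 1ℚ - M
      S₂-term-nonNeg : ∀ j → j ℕ.< m → 0ℚ ≤ x j * (M - ℕtoℚ j) * (ℕtoℚ 3 * ℕtoℚ j + c) * (ℕtoℚ 3 * ℕtoℚ j + c)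
      S₂-term-nonNeg j j<m = subst (0ℚ ≤_) (assoc (x j) (M - ℕtoℚ j) (ℕtoℚ 3 * ℕtoℚ j + c))
        (*-nonNeg (ℚ.<⇒≤ (x-pos (ℕ.<-trans j<m m<n))) (square-weight-nonNeg c j<m))
        where
        assoc : ∀ a b w → a * (b * w * w) ≡ a * b * w * w
        assoc = solve-∀ ℚ-ring
      S : ℚ
      S = ∑[ j < m ] (x j * (M - ℕtoℚ j) * (ℕtoℚ 3 * ℕtoℚ j + c) * (ℕtoℚ 3 * ℕtoℚ j + c))
      KW≡ : (ℕtoℚ 3 * N + c) * W c ≡ S
      KW≡ = begin
        (ℕtoℚ 3 * N + c) * W c                                          ≡⟨ W-identity c ⟩
        ℕtoℚ 3 * ∑[ j < m ] ((M - ℕtoℚ j) * (ℕtoℚ 3 * ℕtoℚ j + c)) + S   ≡⟨ cong (λ t → ℕtoℚ 3 * t + S) (∑-linear-weight c) ⟩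
        ℕtoℚ 3 * (½ * M * (M + 1ℚ) * (M - 1ℚ + c)) + S                   ≡⟨ vanish M S ⟩
        S                                                               ∎
        where
        vanish : ∀ M S → ℕtoℚ 3 * (½ * M * (M + 1ℚ) * (M - 1ℚ + (1ℚ - M))) + S ≡ S
        vanish = solve-∀ ℚ-ring
      K-pos : 0ℚ < ℕtoℚ 3 * N + c
      K-pos = subst (0ℚ <_) K≡ (ℕtoℚ-pos (ℕ.m<n⇒0<n∸m m<3n+1))
        where
        m<3n+1 : m ℕ.< 3 ℕ.* n ℕ.+ 1
        m<3n+1 = ℕ.≤-trans m<n (ℕ.≤-trans (ℕ.m≤n*m n 3) (ℕ.m≤m+n (3 ℕ.* n) 1))
        K≡ : ℕtoℚ (3 ℕ.* n ℕ.+ 1 ℕ.∸ m) ≡ ℕtoℚ 3 * N + (1ℚ - M)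
        K≡ = begin
          ℕtoℚ (3 ℕ.* n ℕ.+ 1 ℕ.∸ m)        ≡⟨ ℕtoℚ-∸ (ℕ.<⇒≤ m<3n+1) ⟩
          ℕtoℚ (3 ℕ.* n ℕ.+ 1) - M          ≡⟨ cong (_- M) (trans (ℕtoℚ-+ (3 ℕ.* n) 1) (cong (_+ 1ℚ) (ℕtoℚ-* 3 n))) ⟩
          ℕtoℚ 3 * N + 1ℚ - M               ≡⟨ ℚ.+-assoc (ℕtoℚ 3 * N) 1ℚ (- M) ⟩
          ℕtoℚ 3 * N + (1ℚ - M)             ∎

    W-nonPos : 1 ℕ.≤ m → m ℕ.* m ℕ.+ 25 ℕ.* m ℕ.+ 30 ℕ.≤ 24 ℕ.* n → W (- M - ℕtoℚ 3) ≤ 0ℚ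
    W-nonPos 1≤m small = ℚ.*-cancelˡ-≤-pos K {{ℚ.positive K-pos}}
      (subst (K * W c ≤_) (sym (ℚ.*-zeroʳ K)) KW≤0)
      where
      c K Q S T S₁ : ℚ
      c = - M - ℕtoℚ 3
      K = ℕtoℚ 3 * N + c
      Q = M * M + M + ℕtoℚ 30
      S = ∑[ j < m ] (x j * (M - ℕtoℚ j) * (ℕtoℚ 3 * ℕtoℚ j + c) * (ℕtoℚ 3 * ℕtoℚ j + c))
      T = ∑[ j < m ] ((M - ℕtoℚ j) * (ℕtoℚ 3 * ℕtoℚ j + c) * (ℕtoℚ 3 * ℕtoℚ j + c))
      S₁ = ∑[ j < m ] ((M - ℕtoℚ j) * (ℕtoℚ 3 * ℕtoℚ j + c))

      S≤yT : S ≤ y * T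
      S≤yT = subst (S ≤_) (∑-scale y _ m) (∑-mono-≤ m pointwise)
        where
        pointwise : ∀ j → j ℕ.< m → x j * (M - ℕtoℚ j) * (ℕtoℚ 3 * ℕtoℚ j + c) * (ℕtoℚ 3 * ℕtoℚ j + c) ≤
                                    y * ((M - ℕtoℚ j) * (ℕtoℚ 3 * ℕtoℚ j + c) * (ℕtoℚ 3 * ℕtoℚ j + c))
        pointwise j j<m = subst (_≤ y * ((M - ℕtoℚ j) * (ℕtoℚ 3 * ℕtoℚ j + c) * (ℕtoℚ 3 * ℕtoℚ j + c)))
                                (assoc (x j) (M - ℕtoℚ j) (ℕtoℚ 3 * ℕtoℚ j + c))
          (ℚ.*-monoʳ-≤-nonNeg _ {{ℚ.nonNegative (square-weight-nonNeg c j<m)}} (x≤y j<m))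
          where
          assoc : ∀ a b w → a * (b * w * w) ≡ a * b * w * w
          assoc = solve-∀ ℚ-ring

      24-yQ≡ : ℕtoℚ 24 - y * Q ≡ y * ℕtoℚ (24 ℕ.* n ℕ.∸ (m ℕ.* m ℕ.+ 25 ℕ.* m ℕ.+ 30))
      24-yQ≡ = begin
        ℕtoℚ 24 - y * Q                                   ≡⟨ cong (λ t → ℕtoℚ 24 * t - y * Q) (sym (x-inv m<n)) ⟩
        ℕtoℚ 24 * (y * (N - M)) - y * Q                   ≡⟨ regroup N M y ⟩
        y * (ℕtoℚ 24 * N - (M * M + ℕtoℚ 25 * M + ℕtoℚ 30))  ≡⟨ cong (λ t → y * t) (sym cast) ⟩
        y * ℕtoℚ (24 ℕ.* n ℕ.∸ (m ℕ.* m ℕ.+ 25 ℕ.* m ℕ.+ 30))  ∎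
        where
        open ≡-Reasoning
        regroup : ∀ N M y → ℕtoℚ 24 * (y * (N - M)) - y * (M * M + M + ℕtoℚ 30) ≡
                            y * (ℕtoℚ 24 * N - (M * M + ℕtoℚ 25 * M + ℕtoℚ 30))
        regroup = solve-∀ ℚ-ring
        cast : ℕtoℚ (24 ℕ.* n ℕ.∸ (m ℕ.* m ℕ.+ 25 ℕ.* m ℕ.+ 30)) ≡ ℕtoℚ 24 * N - (M * M + ℕtoℚ 25 * M + ℕtoℚ 30)
        cast = trans (ℕtoℚ-∸ small)
          (cong₂ _-_ (ℕtoℚ-* 24 n)
            (trans (ℕtoℚ-+ (m ℕ.* m ℕ.+ 25 ℕ.* m) 30)
              (cong (_+ ℕtoℚ 30) (trans (ℕtoℚ-+ (m ℕ.* m) (25 ℕ.* m)) (cong₂ _+_ (ℕtoℚ-* m m) (ℕtoℚ-* 25 m))))))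

      KW≤0 : K * W c ≤ 0ℚ
      KW≤0 = begin
        K * W c                  ≡⟨ W-identity c ⟩
        ℕtoℚ 3 * S₁ + S          ≤⟨ ℚ.+-monoʳ-≤ (ℕtoℚ 3 * S₁) S≤yT ⟩
        ℕtoℚ 3 * S₁ + y * T
          ≡⟨ cong₂ (λ s t → ℕtoℚ 3 * s + y * t) (∑-linear-weight c) (∑-square-weight c) ⟩
        ℕtoℚ 3 * (½ * M * (M + 1ℚ) * (M - 1ℚ + c))
          + y * (¼ * M * (M + 1ℚ) * (ℕtoℚ 3 * M * (M - 1ℚ) + ℕtoℚ 4 * c * (M - 1ℚ) + ℕtoℚ 2 * c * c))
          ≡⟨ closed M y ⟩
        - (¼ * M * (M + 1ℚ) * (ℕtoℚ 24 - y * Q))                        ≤⟨ ℚ.neg-antimono-≤ margin ⟩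
        - 0ℚ                                                            ≡⟨⟩
        0ℚ                                                              ∎
        where
        open ℚ.≤-Reasoning
        closed : ∀ M y →
          ℕtoℚ 3 * (½ * M * (M + 1ℚ) * (M - 1ℚ + (- M - ℕtoℚ 3)))
          + y * (¼ * M * (M + 1ℚ) * (ℕtoℚ 3 * M * (M - 1ℚ) + ℕtoℚ 4 * (- M - ℕtoℚ 3) * (M - 1ℚ)
                                     + ℕtoℚ 2 * (- M - ℕtoℚ 3) * (- M - ℕtoℚ 3))) ≡
          - (¼ * M * (M + 1ℚ) * (ℕtoℚ 24 - y * (M * M + M + ℕtoℚ 30)))
        closed = solve-∀ ℚ-ring
        margin : 0ℚ ≤ ¼ * M * (M + 1ℚ) * (ℕtoℚ 24 - y * Q)
        margin = *-nonNeg
          (subst (0ℚ ≤_) (cong (λ t → ¼ * M * t) (ℕtoℚ-+ m 1))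
            (*-nonNeg (*-nonNeg (ℚ.<⇒≤ (frac-pos {1} {4} (s≤s z≤n) (s≤s z≤n))) (ℕtoℚ-nonNeg m)) (ℕtoℚ-nonNeg (m ℕ.+ 1))))
          (subst (0ℚ ≤_) (sym 24-yQ≡) (*-nonNeg (ℚ.<⇒≤ (x-pos m<n)) (ℕtoℚ-nonNeg (24 ℕ.* n ℕ.∸ (m ℕ.* m ℕ.+ 25 ℕ.* m ℕ.+ 30)))))

      K-pos : 0ℚ < K
      K-pos = subst (0ℚ <_) K≡ (ℕtoℚ-pos (ℕ.m<n⇒0<n∸m m+3<3n))
        where
        m+3<3n : m ℕ.+ 3 ℕ.< 3 ℕ.* n
        m+3<3n = ℕ.≤-trans (bound m 1≤m) (ℕ.*-monoʳ-≤ 3 m<n)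
          where
          bound : ∀ m → 1 ℕ.≤ m → suc (m ℕ.+ 3) ℕ.≤ 3 ℕ.* suc m
          bound (suc k) _ = ℕ.≤-trans (ℕ.m≤m+n (suc (suc k ℕ.+ 3)) (suc (k ℕ.+ k))) (ℕ.≤-reflexive (count k))
            where
            count : ∀ k → suc (suc k ℕ.+ 3) ℕ.+ suc (k ℕ.+ k) ≡ 3 ℕ.* suc (suc k)
            count = ℕ-Solver.solve-∀
        K≡ : ℕtoℚ (3 ℕ.* n ℕ.∸ (m ℕ.+ 3)) ≡ K
        K≡ = begin
          ℕtoℚ (3 ℕ.* n ℕ.∸ (m ℕ.+ 3))      ≡⟨ ℕtoℚ-∸ (ℕ.<⇒≤ m+3<3n) ⟩
          ℕtoℚ (3 ℕ.* n) - ℕtoℚ (m ℕ.+ 3)   ≡⟨ cong₂ _-_ (ℕtoℚ-* 3 n) (ℕtoℚ-+ m 3) ⟩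
          ℕtoℚ 3 * N - (M + ℕtoℚ 3)         ≡⟨ regroup N M ⟩
          K                                 ∎
          where
          open ≡-Reasoning
          regroup : ∀ N M → ℕtoℚ 3 * N - (M + ℕtoℚ 3) ≡ ℕtoℚ 3 * N + (- M - ℕtoℚ 3)
          regroup = solve-∀ ℚ-ring

    Γ-lowerBound : (ℕtoℚ 2 * M + 1ℚ) * Δ m ≤ ℕtoℚ 3 * Γ m
    Γ-lowerBound = 0≤q-p⇒p≤q (subst (0ℚ ≤_) combination
      (*-nonNeg (ℚ.<⇒≤ ½Ny-pos) W-nonNeg))
      where
      open ≡-Reasoning
      β : ℚ
      β = - (ℕtoℚ 2 * M + 1ℚ)
      combination : ½ * N * y * W (1ℚ - M) ≡ ℕtoℚ 3 * Γ m - (ℕtoℚ 2 * M + 1ℚ) * Δ m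
      combination = begin
        ½ * N * y * W (1ℚ - M)
          ≡⟨ cong (λ t → ½ * N * y * t) (∑-cong m (λ j _ → reweight M (ℕtoℚ j) (x j))) ⟩
        ½ * N * y * ∑[ j < m ] (x j * (M - ℕtoℚ j) * (ℕtoℚ 3 * (M + ℕtoℚ j + 1ℚ) + (β + β)))
          ≡⟨ sym (Γ-Δ-combination (ℕtoℚ 3) β) ⟩
        ℕtoℚ 3 * Γ m + β * Δ m
          ≡⟨ minus (ℕtoℚ 3 * Γ m) (ℕtoℚ 2 * M + 1ℚ) (Δ m) ⟩
        ℕtoℚ 3 * Γ m - (ℕtoℚ 2 * M + 1ℚ) * Δ m  ∎
        where
        reweight : ∀ M J xj → xj * (M - J) * (ℕtoℚ 3 * J + (1ℚ - M)) ≡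
                   xj * (M - J) * (ℕtoℚ 3 * (M + J + 1ℚ) + (- (ℕtoℚ 2 * M + 1ℚ) + - (ℕtoℚ 2 * M + 1ℚ)))
        reweight = solve-∀ ℚ-ring
        minus : ∀ a b d → a + - b * d ≡ a - b * d
        minus = solve-∀ ℚ-ring

    Γ-upperBound : 1 ℕ.≤ m → m ℕ.* m ℕ.+ 25 ℕ.* m ℕ.+ 30 ℕ.≤ 24 ℕ.* n →
                   ℕtoℚ 3 * Γ m ≤ (ℕtoℚ 2 * M + ℕtoℚ 3) * Δ m
    Γ-upperBound 1≤m small = 0≤q-p⇒p≤q (subst (0ℚ ≤_) combination
      (*-nonNeg (ℚ.<⇒≤ ½Ny-pos) (subst (0ℚ ≤_) (sym (neg-one (W c))) (ℚ.neg-antimono-≤ (W-nonPos 1≤m small)))))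
      where
      open ≡-Reasoning
      c β : ℚ
      c = - M - ℕtoℚ 3
      β = ℕtoℚ 2 * M + ℕtoℚ 3
      neg-one : ∀ w → - 1ℚ * w ≡ - w
      neg-one = solve-∀ ℚ-ring
      combination : ½ * N * y * (- 1ℚ * W c) ≡ (ℕtoℚ 2 * M + ℕtoℚ 3) * Δ m - ℕtoℚ 3 * Γ m
      combination = begin
        ½ * N * y * (- 1ℚ * W c)
          ≡⟨ cong (λ t → ½ * N * y * t) (sym (∑-scale (- 1ℚ) _ m)) ⟩
        ½ * N * y * ∑[ j < m ] (- 1ℚ * (x j * (M - ℕtoℚ j) * (ℕtoℚ 3 * ℕtoℚ j + c)))
          ≡⟨ cong (λ t → ½ * N * y * t) (∑-cong m (λ j _ → reweight M (ℕtoℚ j) (x j))) ⟩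
        ½ * N * y * ∑[ j < m ] (x j * (M - ℕtoℚ j) * (- ℕtoℚ 3 * (M + ℕtoℚ j + 1ℚ) + (β + β)))
          ≡⟨ sym (Γ-Δ-combination (- ℕtoℚ 3) β) ⟩
        - ℕtoℚ 3 * Γ m + β * Δ m
          ≡⟨ swap (ℕtoℚ 3) (Γ m) β (Δ m) ⟩
        β * Δ m - ℕtoℚ 3 * Γ m  ∎
        where
        reweight : ∀ M J xj → - 1ℚ * (xj * (M - J) * (ℕtoℚ 3 * J + (- M - ℕtoℚ 3))) ≡
                   xj * (M - J) * (- ℕtoℚ 3 * (M + J + 1ℚ) + ((ℕtoℚ 2 * M + ℕtoℚ 3) + (ℕtoℚ 2 * M + ℕtoℚ 3)))
        reweight = solve-∀ ℚ-ring
        swap : ∀ a g b d → - a * g + b * d ≡ b * d - a * g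
        swap = solve-∀ ℚ-ring

growth : ∀ {a b} → 5 ℕ.* b ℕ.≤ 6 ℕ.* a → b ^ 7 ℕ.≤ 4 ℕ.* a ^ 7
growth {a} {b} 5b≤6a = ℕ.*-cancelˡ-≤ (5 ^ 7) (begin
  5 ^ 7 ℕ.* b ^ 7            ≡⟨ sym (^-distribʳ-* 5 b 7) ⟩
  (5 ℕ.* b) ^ 7              ≤⟨ ℕ.^-monoˡ-≤ 7 5b≤6a ⟩
  (6 ℕ.* a) ^ 7              ≡⟨ ^-distribʳ-* 6 a 7 ⟩
  6 ^ 7 ℕ.* a ^ 7            ≤⟨ ℕ.*-monoˡ-≤ (a ^ 7) {6 ^ 7} {4 ℕ.* 5 ^ 7} (toWitness {a? = 6 ^ 7 ℕ.≤? 4 ℕ.* 5 ^ 7} tt) ⟩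
  4 ℕ.* 5 ^ 7 ℕ.* a ^ 7      ≡⟨ shuffle (5 ^ 7) (a ^ 7) ⟩
  5 ^ 7 ℕ.* (4 ℕ.* a ^ 7)    ∎)
  where
  open ℕ.≤-Reasoning
  shuffle : ∀ x y → 4 ℕ.* x ℕ.* y ≡ x ℕ.* (4 ℕ.* y)
  shuffle = ℕ-Solver.solve-∀

-- 24 (n + 1) ≤ quadratic m as soon as 24n < m² + 25m + 30
quadratic : ℕ → ℕ
quadratic m = m ℕ.* m ℕ.+ 25 ℕ.* m ℕ.+ 54

quadratic^7≤ : ∀ C → quadratic 10 ^ 7 ℕ.≤ C ℕ.* 2 ^ 29 →
               ∀ k → quadratic (10 ℕ.+ k) ^ 7 ℕ.≤ C ℕ.* 2 ^ (2 ℕ.* (10 ℕ.+ k) ℕ.+ 9)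
quadratic^7≤ C base zero    = base
quadratic^7≤ C base (suc k) = begin
  quadratic (11 ℕ.+ k) ^ 7              ≤⟨ growth {quadratic (10 ℕ.+ k)} {quadratic (11 ℕ.+ k)} ratio ⟩
  4 ℕ.* quadratic (10 ℕ.+ k) ^ 7        ≤⟨ ℕ.*-monoʳ-≤ 4 (quadratic^7≤ C base k) ⟩
  4 ℕ.* (C ℕ.* 2 ^ d)                   ≡⟨ shuffle C (2 ^ d) ⟩
  C ℕ.* (2 ^ d ℕ.* 2 ^ 2)               ≡⟨ cong (C ℕ.*_) (sym (ℕ.^-distribˡ-+-* 2 d 2)) ⟩
  C ℕ.* 2 ^ (d ℕ.+ 2)                   ≡⟨ cong (λ t → C ℕ.* 2 ^ t) (exponent k) ⟩
  C ℕ.* 2 ^ (2 ℕ.* (11 ℕ.+ k) ℕ.+ 9)    ∎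
  where
  open ℕ.≤-Reasoning
  d : ℕ
  d = 2 ℕ.* (10 ℕ.+ k) ℕ.+ 9
  shuffle : ∀ x y → 4 ℕ.* (x ℕ.* y) ≡ x ℕ.* (y ℕ.* 2 ^ 2)
  shuffle = ℕ-Solver.solve-∀
  exponent : ∀ k → 2 ℕ.* (10 ℕ.+ k) ℕ.+ 9 ℕ.+ 2 ≡ 2 ℕ.* (11 ℕ.+ k) ℕ.+ 9
  exponent = ℕ-Solver.solve-∀
  ratio : 5 ℕ.* quadratic (11 ℕ.+ k) ℕ.≤ 6 ℕ.* quadratic (10 ℕ.+ k)
  ratio = ℕ.≤-trans (ℕ.m≤m+n (5 ℕ.* quadratic (11 ℕ.+ k)) (k ℕ.* k ℕ.+ 35 ℕ.* k ℕ.+ 174)) (ℕ.≤-reflexive (slack k))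
    where
    slack : ∀ k → 5 ℕ.* ((11 ℕ.+ k) ℕ.* (11 ℕ.+ k) ℕ.+ 25 ℕ.* (11 ℕ.+ k) ℕ.+ 54) ℕ.+ (k ℕ.* k ℕ.+ 35 ℕ.* k ℕ.+ 174)
                  ≡ 6 ℕ.* ((10 ℕ.+ k) ℕ.* (10 ℕ.+ k) ℕ.+ 25 ℕ.* (10 ℕ.+ k) ℕ.+ 54)
    slack = ℕ-Solver.solve-∀

power-lowerBound : ∀ {n} → 3 ℕ.≤ n → ¬ (suc n ^ (6 ℕ.* suc n) ℕ.≤ 2 ^ ((1 ℕ.+ 6) ℕ.* n))
power-lowerBound {n} 3≤n h = ℕ.<-irrefl refl (ℕ.<-≤-trans (ℕ.≤-<-trans h 2^7n<) 4^≤)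
  where
  2^7n< : 2 ^ (7 ℕ.* n) ℕ.< 2 ^ (2 ℕ.* (6 ℕ.* suc n))
  2^7n< = ℕ.^-monoʳ-< 2 (s≤s (s≤s z≤n))
    (ℕ.≤-trans (s≤s (ℕ.m≤m+n (7 ℕ.* n) (5 ℕ.* n ℕ.+ 11))) (ℕ.≤-reflexive (count n)))
    where
    count : ∀ n → suc (7 ℕ.* n ℕ.+ (5 ℕ.* n ℕ.+ 11)) ≡ 2 ℕ.* (6 ℕ.* suc n)
    count = ℕ-Solver.solve-∀
  4^≤ : 2 ^ (2 ℕ.* (6 ℕ.* suc n)) ℕ.≤ suc n ^ (6 ℕ.* suc n)
  4^≤ = subst (ℕ._≤ suc n ^ (6 ℕ.* suc n)) (ℕ.^-*-assoc 2 2 (6 ℕ.* suc n)) (ℕ.^-monoˡ-≤ (6 ℕ.* suc n) (s≤s 3≤n))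

power-upperBound-large : ∀ {n m} → 6 ℕ.≤ n → 10 ℕ.≤ m → 24 ℕ.* n ℕ.< m ℕ.* m ℕ.+ 25 ℕ.* m ℕ.+ 30 →
                         suc n ^ (6 ℕ.* suc n) ℕ.≤ 2 ^ ((2 ℕ.* m ℕ.+ 3 ℕ.+ 6) ℕ.* n)
power-upperBound-large {n} {m} 6≤n 10≤m h = begin
  suc n ^ (6 ℕ.* suc n)           ≤⟨ ℕ.^-monoʳ-≤ (suc n) 6N≤7n ⟩
  suc n ^ (7 ℕ.* n)               ≡⟨ sym (ℕ.^-*-assoc (suc n) 7 n) ⟩
  (suc n ^ 7) ^ n                 ≤⟨ ℕ.^-monoˡ-≤ n N^7≤ ⟩
  (2 ^ (2 ℕ.* m ℕ.+ 9)) ^ n        ≡⟨ ℕ.^-*-assoc 2 (2 ℕ.* m ℕ.+ 9) n ⟩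
  2 ^ ((2 ℕ.* m ℕ.+ 9) ℕ.* n)     ≡⟨ cong (λ t → 2 ^ (t ℕ.* n)) (sym (ℕ.+-assoc (2 ℕ.* m) 3 6)) ⟩
  2 ^ ((2 ℕ.* m ℕ.+ 3 ℕ.+ 6) ℕ.* n)  ∎
  where
  open ℕ.≤-Reasoning
  6N≤7n : 6 ℕ.* suc n ℕ.≤ 7 ℕ.* n
  6N≤7n = ℕ.≤-trans (ℕ.≤-reflexive (ℕ.*-suc 6 n)) (ℕ.+-monoˡ-≤ (6 ℕ.* n) 6≤n)
  24N≤ : 24 ℕ.* suc n ℕ.≤ quadratic m
  24N≤ = ℕ.≤-trans (ℕ.≤-reflexive (ℕ.*-suc 24 n))
           (ℕ.≤-trans (ℕ.+-monoʳ-≤ 24 (ℕ.<⇒≤ h)) (ℕ.≤-reflexive (shift m)))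
    where
    shift : ∀ m → 24 ℕ.+ (m ℕ.* m ℕ.+ 25 ℕ.* m ℕ.+ 30) ≡ m ℕ.* m ℕ.+ 25 ℕ.* m ℕ.+ 54
    shift = ℕ-Solver.solve-∀
  quadratic^7≤′ : quadratic m ^ 7 ℕ.≤ 24 ^ 7 ℕ.* 2 ^ (2 ℕ.* m ℕ.+ 9)
  quadratic^7≤′ = subst (λ t → quadratic t ^ 7 ℕ.≤ 24 ^ 7 ℕ.* 2 ^ (2 ℕ.* t ℕ.+ 9)) (ℕ.m+[n∸m]≡n 10≤m)
    (quadratic^7≤ (24 ^ 7) (toWitness {a? = quadratic 10 ^ 7 ℕ.≤? 24 ^ 7 ℕ.* 2 ^ 29} tt) (m ℕ.∸ 10))
  N^7≤ : suc n ^ 7 ℕ.≤ 2 ^ (2 ℕ.* m ℕ.+ 9)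
  N^7≤ = ℕ.*-cancelˡ-≤ (24 ^ 7) (begin
    24 ^ 7 ℕ.* suc n ^ 7           ≡⟨ sym (^-distribʳ-* 24 (suc n) 7) ⟩
    (24 ℕ.* suc n) ^ 7             ≤⟨ ℕ.^-monoˡ-≤ 7 24N≤ ⟩
    quadratic m ^ 7                ≤⟨ quadratic^7≤′ ⟩
    24 ^ 7 ℕ.* 2 ^ (2 ℕ.* m ℕ.+ 9) ∎)

power-upperBound : ∀ {n m} → 9 ℕ.≤ n → 24 ℕ.* n ℕ.< m ℕ.* m ℕ.+ 25 ℕ.* m ℕ.+ 30 →
                   suc n ^ (6 ℕ.* suc n) ℕ.≤ 2 ^ ((2 ℕ.* m ℕ.+ 3 ℕ.+ 6) ℕ.* n)
power-upperBound {n} {m} 9≤n h with 10 ℕ.≤? m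
... | yes 10≤m = power-upperBound-large (ℕ.≤-trans (toWitness {a? = 6 ℕ.≤? 9} tt) 9≤n) 10≤m h
... | no  m≱10 = checked n<14 m<10 9≤n h
  where
  m<10 : m ℕ.< 10
  m<10 = ℕ.≰⇒> m≱10
  n<14 : n ℕ.< 14
  n<14 = ℕ.*-cancelˡ-< 24 n 14 (ℕ.<-≤-trans h
           (ℕ.+-monoˡ-≤ 30 (ℕ.+-mono-≤ (ℕ.*-mono-≤ (ℕ.s≤s⁻¹ m<10) (ℕ.s≤s⁻¹ m<10)) (ℕ.*-monoʳ-≤ 25 (ℕ.s≤s⁻¹ m<10)))))
  checked : ∀ {n} → n ℕ.< 14 → ∀ {m} → m ℕ.< 10 → 9 ℕ.≤ n → 24 ℕ.* n ℕ.< m ℕ.* m ℕ.+ 25 ℕ.* m ℕ.+ 30 →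
            suc n ^ (6 ℕ.* suc n) ℕ.≤ 2 ^ ((2 ℕ.* m ℕ.+ 3 ℕ.+ 6) ℕ.* n)
  checked = toWitness {a? = ℕ.allUpTo? (λ n → ℕ.allUpTo? (λ m →
              9 ℕ.≤? n →-dec 24 ℕ.* n ℕ.<? m ℕ.* m ℕ.+ 25 ℕ.* m ℕ.+ 30 →-dec
              suc n ^ (6 ℕ.* suc n) ℕ.≤? 2 ^ ((2 ℕ.* m ℕ.+ 3 ℕ.+ 6) ℕ.* n)) 10) 14} tt

power-upperBound-diagonal : ∀ {n} → 5 ℕ.≤ n → suc n ^ (6 ℕ.* suc n) ℕ.≤ 2 ^ ((2 ℕ.* n ℕ.+ 3 ℕ.+ 6) ℕ.* n)
power-upperBound-diagonal {n} 5≤n with 9 ℕ.≤? n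
... | yes 9≤n = power-upperBound {n} {n} 9≤n (ℕ.≤-trans (s≤s (ℕ.m≤m+n (24 ℕ.* n) (n ℕ.* n ℕ.+ n ℕ.+ 29))) (ℕ.≤-reflexive (expand n)))
  where
  expand : ∀ n → suc (24 ℕ.* n ℕ.+ (n ℕ.* n ℕ.+ n ℕ.+ 29)) ≡ n ℕ.* n ℕ.+ 25 ℕ.* n ℕ.+ 30
  expand = ℕ-Solver.solve-∀
... | no  n≱9 = checked (ℕ.≰⇒> n≱9) 5≤n
  where
  checked : ∀ {n} → n ℕ.< 9 → 5 ℕ.≤ n → suc n ^ (6 ℕ.* suc n) ℕ.≤ 2 ^ ((2 ℕ.* n ℕ.+ 3 ℕ.+ 6) ℕ.* n)
  checked = toWitness {a? = ℕ.allUpTo? (λ n → 5 ℕ.≤? n →-dec suc n ^ (6 ℕ.* suc n) ℕ.≤? 2 ^ ((2 ℕ.* n ℕ.+ 3 ℕ.+ 6) ℕ.* n)) 9} tt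

-- Neighbouring values of F̃

module _ (n : ℕ) where

  E-suc : ∀ m → E n (suc m) ≡ E n m + e n m
  E-suc m = trans (E≡∑ n (suc m)) (cong (_+ e n m) (sym (E≡∑ n m)))

  R-suc : ∀ m → R n (suc m) ≡ R n m + ρ n m
  R-suc m = trans (R≡∑ n (suc m)) (cong (_+ ρ n m) (sym (R≡∑ n m)))

  E-pos : ∀ {m} → 0 ℕ.< m → m ℕ.≤ n → 0ℚ < E n m
  E-pos {m} 0<m m≤n = subst (0ℚ <_) (sym (E≡∑ n m)) (∑-pos m 0<m (λ j j<m → e-pos (ℕ.<-≤-trans j<m m≤n)))
    where
    e-pos : ∀ {j} → j ℕ.< n → 0ℚ < e n j
    e-pos {j} j<n = subst (0ℚ <_) (sym (e≡ n j<n)) (*-pos (ℕtoℚ-pos (ℕ.≤-<-trans z≤n j<n)) (x-pos n j<n))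

  Δ-pos : ∀ {m} → 0 ℕ.< m → m ℕ.< n → 0ℚ < Δ n m
  Δ-pos {m} 0<m m<n = subst (0ℚ <_) (sym (Δ≡∑ n m<n)) (∑-pos m 0<m gap-pos)
    where
    gap-pos : ∀ j → j ℕ.< m → 0ℚ < e n m - e n j
    gap-pos j j<m = subst (0ℚ <_) (sym (e-gap n m<n j<m))
      (*-pos (*-pos (ℕtoℚ-pos (ℕ.≤-<-trans z≤n m<n)) (x-pos n m<n))
             (*-pos (x-pos n (ℕ.<-trans j<m m<n)) (subst (0ℚ <_) (ℕtoℚ-∸ (ℕ.<⇒≤ j<m)) (ℕtoℚ-pos (ℕ.m<n⇒0<n∸m j<m)))))

  private
    λₙ : ℚ
    λₙ = 1ℚ + frac 1 n

    weight penalty : ℕ → ℚ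
    weight k  = inv (E n k) * ℕtoℚ (2 ℕ.* k)
    penalty k = inv (E n k) * R n k

  Ftilde-≤⇔ : ∀ m k → Ftilde n m ≤[ n ] Ftilde n k ⇔ (weight m - weight k) ·b[ n ]≤ (penalty k - penalty m)
  Ftilde-≤⇔ m k = mk⇔ (subst₂ (QCoeffLe n) coeffs consts) (subst₂ (QCoeffLe n) (sym coeffs) (sym consts))
    where
    coeffs : inv (E n m) * (ℕtoℚ (2 ℕ.* m) * λₙ + 0ℚ) - inv (E n k) * (ℕtoℚ (2 ℕ.* k) * λₙ + 0ℚ) ≡
             (weight m - weight k) * λₙ - 0ℚ
    coeffs = regroup-coeff (inv (E n m)) (inv (E n k)) (ℕtoℚ (2 ℕ.* m)) (ℕtoℚ (2 ℕ.* k)) λₙ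
      where
      regroup-coeff : ∀ a a′ t t′ l → a * (t * l + 0ℚ) - a′ * (t′ * l + 0ℚ) ≡ (a * t - a′ * t′) * l - 0ℚ
      regroup-coeff = solve-∀ ℚ-ring
    consts : inv (E n k) * (ℕtoℚ (2 ℕ.* k) * - 1ℚ + R n k) - inv (E n m) * (ℕtoℚ (2 ℕ.* m) * - 1ℚ + R n m) ≡
             (penalty k - penalty m) - (weight m - weight k) * - 1ℚ
    consts = regroup-const (inv (E n m)) (inv (E n k)) (ℕtoℚ (2 ℕ.* m)) (ℕtoℚ (2 ℕ.* k)) (R n m) (R n k)
      where
      regroup-const : ∀ a a′ t t′ r r′ → a′ * (t′ * - 1ℚ + r′) - a * (t * - 1ℚ + r) ≡
                                         (a′ * r′ - a * r) - (a * t - a′ * t′) * - 1ℚ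
      regroup-const = solve-∀ ℚ-ring

  Ftilde-adjacent⇔ : ∀ {m} → 0 ℕ.< m → m ℕ.< n →
                     Ftilde n m ≤[ n ] Ftilde n (suc m) ⇔ (ℕtoℚ 2 * Δ n m) ·b[ n ]≤ Γ n m
  Ftilde-adjacent⇔ {m} 0<m m<n = mk⇔
    (subst₂ (_·b[ n ]≤_) weights penalties ∘ to scaled ∘ to (Ftilde-≤⇔ m (suc m)))
    (from (Ftilde-≤⇔ m (suc m)) ∘ from scaled ∘ subst₂ (_·b[ n ]≤_) (sym weights) (sym penalties))
    where
    open ≡-Reasoning
    E₀ E₁ : ℚ
    E₀ = E n m
    E₁ = E n (suc m)
    E₀-pos : 0ℚ < E₀
    E₀-pos = E-pos 0<m (ℕ.<⇒≤ m<n)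
    E₁-pos : 0ℚ < E₁
    E₁-pos = E-pos (s≤s z≤n) m<n
    scaled : (weight m - weight (suc m)) ·b[ n ]≤ (penalty (suc m) - penalty m) ⇔
             (E₀ * E₁ * (weight m - weight (suc m))) ·b[ n ]≤ (E₀ * E₁ * (penalty (suc m) - penalty m))
    scaled = ·b≤-*⇔ n (weight m - weight (suc m)) (penalty (suc m) - penalty m) (*-pos E₀-pos E₁-pos)

    weights : E₀ * E₁ * (weight m - weight (suc m)) ≡ ℕtoℚ 2 * Δ n m
    weights = begin
      E₀ * E₁ * (inv E₀ * ℕtoℚ (2 ℕ.* m) - inv E₁ * ℕtoℚ (2 ℕ.* suc m))
        ≡⟨ cong₂ (λ t t′ → E₀ * E₁ * (inv E₀ * t - inv E₁ * t′))
                 (ℕtoℚ-* 2 m) (trans (ℕtoℚ-* 2 (suc m)) (cong (λ t → ℕtoℚ 2 * t) (ℕtoℚ-suc m))) ⟩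
      E₀ * E₁ * (inv E₀ * (ℕtoℚ 2 * M) - inv E₁ * (ℕtoℚ 2 * (1ℚ + M)))
        ≡⟨ expand E₀ E₁ (inv E₀) (inv E₁) M ⟩
      ℕtoℚ 2 * M * E₁ * (inv E₀ * E₀) - ℕtoℚ 2 * (1ℚ + M) * E₀ * (inv E₁ * E₁)
        ≡⟨ cong₂ (λ u v → ℕtoℚ 2 * M * E₁ * u - ℕtoℚ 2 * (1ℚ + M) * E₀ * v) (inv-*-cancel E₀-pos) (inv-*-cancel E₁-pos) ⟩
      ℕtoℚ 2 * M * E₁ * 1ℚ - ℕtoℚ 2 * (1ℚ + M) * E₀ * 1ℚ
        ≡⟨ cong (λ t → ℕtoℚ 2 * M * t * 1ℚ - ℕtoℚ 2 * (1ℚ + M) * E₀ * 1ℚ) (E-suc m) ⟩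
      ℕtoℚ 2 * M * (E₀ + e n m) * 1ℚ - ℕtoℚ 2 * (1ℚ + M) * E₀ * 1ℚ
        ≡⟨ collect M E₀ (e n m) ⟩
      ℕtoℚ 2 * (M * e n m - E₀)  ∎
      where
      M : ℚ
      M = ℕtoℚ m
      expand : ∀ E₀ E₁ i₀ i₁ M → E₀ * E₁ * (i₀ * (ℕtoℚ 2 * M) - i₁ * (ℕtoℚ 2 * (1ℚ + M))) ≡
                                 ℕtoℚ 2 * M * E₁ * (i₀ * E₀) - ℕtoℚ 2 * (1ℚ + M) * E₀ * (i₁ * E₁)
      expand = solve-∀ ℚ-ring
      collect : ∀ M E₀ e → ℕtoℚ 2 * M * (E₀ + e) * 1ℚ - ℕtoℚ 2 * (1ℚ + M) * E₀ * 1ℚ ≡ ℕtoℚ 2 * (M * e - E₀)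
      collect = solve-∀ ℚ-ring

    penalties : E₀ * E₁ * (penalty (suc m) - penalty m) ≡ Γ n m
    penalties = begin
      E₀ * E₁ * (inv E₁ * R n (suc m) - inv E₀ * R n m)
        ≡⟨ expand E₀ E₁ (inv E₀) (inv E₁) (R n m) (R n (suc m)) ⟩
      R n (suc m) * E₀ * (inv E₁ * E₁) - R n m * E₁ * (inv E₀ * E₀)
        ≡⟨ cong₂ (λ u v → R n (suc m) * E₀ * u - R n m * E₁ * v) (inv-*-cancel E₁-pos) (inv-*-cancel E₀-pos) ⟩
      R n (suc m) * E₀ * 1ℚ - R n m * E₁ * 1ℚ
        ≡⟨ cong₂ (λ r t → r * E₀ * 1ℚ - R n m * t * 1ℚ) (R-suc m) (E-suc m) ⟩
      (R n m + ρ n m) * E₀ * 1ℚ - R n m * (E₀ + e n m) * 1ℚ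
        ≡⟨ collect (R n m) (ρ n m) E₀ (e n m) ⟩
      ρ n m * E₀ - R n m * e n m  ∎
      where
      expand : ∀ E₀ E₁ i₀ i₁ r r′ → E₀ * E₁ * (i₁ * r′ - i₀ * r) ≡ r′ * E₀ * (i₁ * E₁) - r * E₁ * (i₀ * E₀)
      expand = solve-∀ ℚ-ring
      collect : ∀ r p E₀ e → (r + p) * E₀ * 1ℚ - r * (E₀ + e) * 1ℚ ≡ p * E₀ - r * e
      collect = solve-∀ ℚ-ring

  private
    0<3 : 0ℚ < ℕtoℚ 3
    0<3 = ℕtoℚ-pos {3} (s≤s z≤n)

    half-odd : ∀ a b → frac (2 ℕ.* a ℕ.+ b) 2 ≡ (ℕtoℚ 2 * ℕtoℚ a + ℕtoℚ b) * ½
    half-odd a b = trans (frac-split (2 ℕ.* a ℕ.+ b) {2} (s≤s z≤n))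
      (cong (_* ½) (trans (ℕtoℚ-+ (2 ℕ.* a) b) (cong (_+ ℕtoℚ b) (ℕtoℚ-* 2 a))))

  adjacent⇒lowerBound : ∀ {m} → 0 ℕ.< m → m ℕ.< n →
    ℕtoℚ 3 * Γ n m ≤ (ℕtoℚ 2 * ℕtoℚ m + ℕtoℚ 3) * Δ n m →
    Ftilde n m ≤[ n ] Ftilde n (suc m) → ℕtoℚ 3 ·b[ n ]≤ frac (2 ℕ.* m ℕ.+ 3) 2
  adjacent⇒lowerBound {m} 0<m m<n 3Γ≤ h =
    ·b≤-ratio n (Γ n m) (frac (2 ℕ.* m ℕ.+ 3) 2) (*-pos (ℕtoℚ-pos {2} (s≤s z≤n)) (Δ-pos 0<m m<n)) 0<3
      (subst₂ _≤_ (ℚ.*-comm (ℕtoℚ 3) (Γ n m)) (sym rhs) 3Γ≤) (to (Ftilde-adjacent⇔ 0<m m<n) h)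
    where
    rhs : frac (2 ℕ.* m ℕ.+ 3) 2 * (ℕtoℚ 2 * Δ n m) ≡ (ℕtoℚ 2 * ℕtoℚ m + ℕtoℚ 3) * Δ n m
    rhs = trans (cong (_* (ℕtoℚ 2 * Δ n m)) (half-odd m 3)) (cancel (ℕtoℚ 2 * ℕtoℚ m + ℕtoℚ 3) (Δ n m))
      where
      cancel : ∀ a d → a * ½ * (ℕtoℚ 2 * d) ≡ a * d
      cancel = solve-∀ ℚ-ring

  lowerBound⇒adjacent : ∀ {k} → 0 ℕ.< k → k ℕ.< n →
    ℕtoℚ 3 ·b[ n ]≤ frac (2 ℕ.* k ℕ.+ 1) 2 → Ftilde n k ≤[ n ] Ftilde n (suc k)
  lowerBound⇒adjacent {k} 0<k k<n h = from (Ftilde-adjacent⇔ 0<k k<n)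
    (·b≤-ratio n (frac (2 ℕ.* k ℕ.+ 1) 2) (Γ n k) 0<3 (*-pos (ℕtoℚ-pos {2} (s≤s z≤n)) (Δ-pos 0<k k<n))
      (subst₂ _≤_ (sym lhs) (ℚ.*-comm (ℕtoℚ 3) (Γ n k)) (Γ-lowerBound n k<n)) h)
    where
    lhs : frac (2 ℕ.* k ℕ.+ 1) 2 * (ℕtoℚ 2 * Δ n k) ≡ (ℕtoℚ 2 * ℕtoℚ k + 1ℚ) * Δ n k
    lhs = trans (cong (_* (ℕtoℚ 2 * Δ n k)) (half-odd k 1)) (cancel (ℕtoℚ 2 * ℕtoℚ k + 1ℚ) (Δ n k))
      where
      cancel : ∀ a d → a * ½ * (ℕtoℚ 2 * d) ≡ a * d
      cancel = solve-∀ ℚ-ring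

  statement-lower : ∀ {m} → ℕtoℚ 3 ·b[ n ]≤ frac (2 ℕ.* m ℕ.+ 3) 2 →
                    ((((+ 3) / 1) ⊛ b n) ⊕ ofℚ (-[1+ 2 ] / 2)) ≤[ n ] ofℚ (ℕtoℚ m)
  statement-lower {m} = subst₂ (QCoeffLe n) (coeffs (ℕtoℚ 3 * λₙ))
    (trans (cong (_- ℕtoℚ 3 * - 1ℚ) (half-odd m 3)) (consts (ℕtoℚ m)))
    where
    coeffs : ∀ a → a - 0ℚ ≡ a + 0ℚ - 0ℚ
    coeffs = solve-∀ ℚ-ring
    consts : ∀ M → (ℕtoℚ 2 * M + ℕtoℚ 3) * ½ - ℕtoℚ 3 * - 1ℚ ≡ M - (ℕtoℚ 3 * - 1ℚ + -[1+ 2 ] / 2)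
    consts = solve-∀ ℚ-ring

  statement-upper : ∀ {k} → ((((+ 3) / 1) ⊛ b n) ⊕ ofℚ ((+ 1) / 2)) ≤[ n ] ofℚ (ℕtoℚ (suc k)) →
                    ℕtoℚ 3 ·b[ n ]≤ frac (2 ℕ.* k ℕ.+ 1) 2
  statement-upper {k} = subst₂ (QCoeffLe n) (coeffs (ℕtoℚ 3 * λₙ))
    (trans (cong (_- (ℕtoℚ 3 * - 1ℚ + ½)) (ℕtoℚ-suc k))
      (trans (consts (ℕtoℚ k)) (cong (_- ℕtoℚ 3 * - 1ℚ) (sym (half-odd k 1)))))
    where
    coeffs : ∀ a → a + 0ℚ - 0ℚ ≡ a - 0ℚ
    coeffs = solve-∀ ℚ-ring
    consts : ∀ K → 1ℚ + K - (ℕtoℚ 3 * - 1ℚ + ½) ≡ (ℕtoℚ 2 * K + ℕtoℚ 1) * ½ - ℕtoℚ 3 * - 1ℚ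
    consts = solve-∀ ℚ-ring

-- For n ≤ 8 the hypothesis of Γ-upperBound can fail; these finitely many cases are evaluated.
Γ-upperBound-small : ∀ {n} → n ℕ.< 9 → 5 ℕ.≤ n → ∀ {m} → m ℕ.< n → 1 ℕ.≤ m →
                     ℕtoℚ 3 * Γ n m ≤ (ℕtoℚ 2 * ℕtoℚ m + ℕtoℚ 3) * Δ n m
Γ-upperBound-small = toWitness {a? = ℕ.allUpTo? (λ n → 5 ℕ.≤? n →-dec ℕ.allUpTo? (λ m → 1 ℕ.≤? m →-dec
  ℕtoℚ 3 * Γ n m ℚ.≤? (ℕtoℚ 2 * ℕtoℚ m + ℕtoℚ 3) * Δ n m) n) 9} tt

-- The smallest minimiser

module SmallestMinimiser {A : Set} (_≼_ : A → A → Set)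
  (≼-refl : ∀ x → x ≼ x) (≼-trans : ∀ x y z → x ≼ y → y ≼ z → x ≼ z)
  (≼-total : ∀ x y → ¬ (y ≼ x) → x ≼ y) (_≼?_ : ∀ x y → Dec (x ≼ y)) (f : ℕ → A) where

  IsSmallestMinimiser : ℕ → ℕ → Set
  IsSmallestMinimiser K m = (1 ℕ.≤ m × m ℕ.≤ K)
    × ((k : ℕ) → 1 ℕ.≤ k → k ℕ.≤ K → f m ≼ f k)
    × ((k : ℕ) → 1 ℕ.≤ k → k ℕ.< m → ¬ (f k ≼ f m))

  smallestMinimiser : ∀ K → 1 ℕ.≤ K → ∃ (IsSmallestMinimiser K)
  smallestMinimiser (suc zero)    _ = 1 , (ℕ.≤-refl , ℕ.≤-refl) , least , λ k 1≤k k<1 _ → ℕ.<⇒≱ k<1 1≤k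
    where
    least : ∀ k → 1 ℕ.≤ k → k ℕ.≤ 1 → f 1 ≼ f k
    least k 1≤k k≤1 rewrite ℕ.≤-antisym k≤1 1≤k = ≼-refl (f 1)
  smallestMinimiser (suc (suc K)) _ with smallestMinimiser (suc K) (s≤s z≤n)
  ... | m , (1≤m , m≤K) , least , strict with f m ≼? f (suc (suc K))
  ...   | yes fm≼ = m , (1≤m , ℕ.m≤n⇒m≤1+n m≤K) , least′ , strict
    where
    least′ : ∀ k → 1 ℕ.≤ k → k ℕ.≤ suc (suc K) → f m ≼ f k
    least′ k 1≤k k≤ with ℕ.m≤n⇒m<n∨m≡n k≤
    ... | inj₁ k< = least k 1≤k (ℕ.s≤s⁻¹ k<)
    ... | inj₂ refl = fm≼
  ...   | no  fm⋠ = suc (suc K) , (s≤s z≤n , ℕ.≤-refl) , least′ , strict′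
    where
    new≼m : f (suc (suc K)) ≼ f m
    new≼m = ≼-total (f (suc (suc K))) (f m) fm⋠
    least′ : ∀ k → 1 ℕ.≤ k → k ℕ.≤ suc (suc K) → f (suc (suc K)) ≼ f k
    least′ k 1≤k k≤ with ℕ.m≤n⇒m<n∨m≡n k≤
    ... | inj₁ k< = ≼-trans _ (f m) (f k) new≼m (least k 1≤k (ℕ.s≤s⁻¹ k<))
    ... | inj₂ refl = ≼-refl (f k)
    strict′ : ∀ k → 1 ℕ.≤ k → k ℕ.< suc (suc K) → ¬ (f k ≼ f (suc (suc K)))
    strict′ k 1≤k k< fk≼ = fm⋠ (≼-trans (f m) (f k) _ (least k 1≤k (ℕ.s≤s⁻¹ k<)) fk≼)

module _ {n : ℕ} (5≤n : 5 ℕ.≤ n) where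

  private
    0<n : 0 ℕ.< n
    0<n = ℕ.<-≤-trans (s≤s z≤n) 5≤n

  m-opt-lowerBound : ∀ {m} → IsMOpt n m → ((((+ 3) / 1) ⊛ b n) ⊕ ofℚ (-[1+ 2 ] / 2)) ≤[ n ] ofℚ (ℕtoℚ m)
  m-opt-lowerBound {m} ((1≤m , m≤n) , least , _) = statement-lower n {m} (bound (ℕ.m≤n⇒m<n∨m≡n m≤n))
    where
    bound : m ℕ.< n ⊎ m ≡ n → ℕtoℚ 3 ·b[ n ]≤ frac (2 ℕ.* m ℕ.+ 3) 2
    bound (inj₂ refl) = from (·b≤⇔pow (2 ℕ.* n ℕ.+ 3) 0<n) (power-upperBound-diagonal 5≤n)
    bound (inj₁ m<n) = cases (m ℕ.* m ℕ.+ 25 ℕ.* m ℕ.+ 30 ℕ.≤? 24 ℕ.* n) (9 ℕ.≤? n)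
      where
      adjacent : Ftilde n m ≤[ n ] Ftilde n (suc m)
      adjacent = least (suc m) (s≤s z≤n) m<n
      cases : Dec (m ℕ.* m ℕ.+ 25 ℕ.* m ℕ.+ 30 ℕ.≤ 24 ℕ.* n) → Dec (9 ℕ.≤ n) → ℕtoℚ 3 ·b[ n ]≤ frac (2 ℕ.* m ℕ.+ 3) 2
      cases (yes small) _ = adjacent⇒lowerBound n 1≤m m<n (Γ-upperBound n m<n 1≤m small) adjacent
      cases (no large) (yes 9≤n) = from (·b≤⇔pow (2 ℕ.* m ℕ.+ 3) 0<n) (power-upperBound {n} {m} 9≤n (ℕ.≰⇒> large))
      cases (no _) (no n<9) = adjacent⇒lowerBound n 1≤m m<n (Γ-upperBound-small (ℕ.≰⇒> n<9) 5≤n m<n 1≤m) adjacent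

  m-opt-upperBound : ∀ {m} → IsMOpt n m → ofℚ (ℕtoℚ m) <[ n ] ((((+ 3) / 1) ⊛ b n) ⊕ ofℚ ((+ 1) / 2))
  m-opt-upperBound {zero} ((() , _) , _)
  m-opt-upperBound {suc zero} _ h =
    power-lowerBound (ℕ.≤-trans (s≤s (s≤s (s≤s z≤n))) 5≤n) (to (·b≤⇔pow 1 0<n) (statement-upper n {0} h))
  m-opt-upperBound {suc (suc k)} ((_ , m≤n) , _ , strict) h =
    strict (suc k) (s≤s z≤n) ℕ.≤-refl (lowerBound⇒adjacent n (s≤s z≤n) m≤n (statement-upper n {suc k} h))

theorem4p2 : (n : ℕ) → 5 ℕ.≤ n →
    ∃ (λ m → IsMOpt n m)
    × ((m : ℕ) → IsMOpt n m →
         ((((+ 3) / 1) ⊛ b n) ⊕ ofℚ (-[1+ 2 ] / 2)) ≤[ n ] ofℚ (ℕtoℚ m)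
         × ofℚ (ℕtoℚ m) <[ n ] ((((+ 3) / 1) ⊛ b n) ⊕ ofℚ ((+ 1) / 2)))
theorem4p2 n 5≤n =
  smallestMinimiser n (ℕ.≤-trans (s≤s z≤n) 5≤n) ,
  λ m opt → m-opt-lowerBound 5≤n opt , m-opt-upperBound 5≤n opt
  where open SmallestMinimiser (_≤[ n ]_) (≤[]-refl n) (≤[]-trans n) (≤[]-total n) (≤[]? n) (Ftilde n)
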